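{- Let $k\ge 1$ and for real numbers $n_1,\dots,n_k$ define the polynomial in $\lambda$ $$g(\lambda)=\prod_{i=1}^k(\lambda-n_i+2)-\sum_{i=1}^k n_i\prod_{j=1,j\ne i}^k(\lambda-n_j+2)=\sum_{i=0}^k \xi_i\lambda^{k-i},$$ so that each coefficient $\xi_i=\xi_i(n_1,\dots,n_k)$ is a polynomial in $n_1,\dots,n_k$. Let $\psi_t(n_1,\dots,n_k)=\sum_{j=1}^k n_j^t$. Then for each $i=1,\dots,k$ there exists a unique polynomial $F^{(i)}(y_1,\dots,y_i)$ (with real coefficients depending only on $k$ and $i$) such that $$\xi_i(n_1,\dots,n_k)=F^{(i)}\big(\psi_1(n_1,\dots,n_k),\psi_2(n_1,\dots,n_k),\dots,\psi_i(n_1,\dots,n_k)\big)$$ for all $n_1,\dots,n_k$. Moreover, there are nonzero constants $c_i$ such that $F^{(i)}(y_1,\dots,y_i)=c_iy_i+G^{(i)}(y_1,\dots,y_{i-1})$ for some polynomial $G^{(i)}$ in the variables $y_1,\dots,y_{i-1}$ only, for $i=1,\dots,k$.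
   Formalization: The numbers $n_1,\dots,n_k$, the coefficients of $F^{(i)}$, $G^{(i)}$ and of the competing polynomials in the uniqueness claim, and the constants $c_i$ are rational rather than real. -}

module Defs where

open import Data.Nat using (ℕ; zero; suc)
open import Data.Fin using (Fin)
open import Data.List using (List; []; _∷_; map)
open import Data.Vec using (Vec; toList)
open import Data.Product using (_×_; _,_)
open import Data.Rational using (ℚ; 0ℚ; 1ℚ; _+_; _*_; _-_; -_)

-- Univariate polynomials over ℚ as ascending coefficient lists
-- (a₀ ∷ a₁ ∷ … represents a₀ + a₁ λ + a₂ λ² + …).

UPoly : Set
UPoly = List ℚ

infixl 6 _+P_
infixl 7 _*P_

_+P_ : UPoly → UPoly → UPoly
[]       +P q        = q
(a ∷ p)  +P []       = a ∷ p
(a ∷ p)  +P (b ∷ q)  = (a + b) ∷ (p +P q)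

scaleP : ℚ → UPoly → UPoly
scaleP c p = map (c *_) p

_*P_ : UPoly → UPoly → UPoly
[]      *P q = []
(a ∷ p) *P q = scaleP a q +P (0ℚ ∷ (p *P q))

prodP : List UPoly → UPoly
prodP []       = 1ℚ ∷ []
prodP (p ∷ ps) = p *P prodP ps

sumP : List UPoly → UPoly
sumP []       = []
sumP (p ∷ ps) = p +P sumP ps

coeff : UPoly → ℕ → ℚ
coeff []      _       = 0ℚ
coeff (a ∷ p) zero    = a
coeff (a ∷ p) (suc d) = coeff p d

picks : {A : Set} → List A → List (A × List A)
picks []       = []
picks (x ∷ xs) = (x , xs) ∷ map (λ { (y , ys) → (y , x ∷ ys) }) (picks xs)

linF : ℚ → UPoly
linF n = (2ℚ - n) ∷ 1ℚ ∷ []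
  where 2ℚ = 1ℚ + 1ℚ

gPoly : List ℚ → UPoly
gPoly ns = prodP (map linF ns)
        +P scaleP (- 1ℚ)
             (sumP (map (λ { (n , rest) → scaleP n (prodP (map linF rest)) }) (picks ns)))

ξ : (k : ℕ) → ℕ → Vec ℚ k → ℚ
ξ k i ns = coeff (gPoly (toList ns)) (k Data.Nat.∸ i)

pow : ℚ → ℕ → ℚ
pow x zero    = 1ℚ
pow x (suc t) = x * pow x t

sumQ : List ℚ → ℚ
sumQ []       = 0ℚ
sumQ (x ∷ xs) = x + sumQ xs

ψ : {k : ℕ} → ℕ → Vec ℚ k → ℚ
ψ t ns = sumQ (map (λ x → pow x t) (toList ns))

data MPoly (n : ℕ) : Set where
  con  : ℚ → MPoly n
  var  : Fin n → MPoly n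
  _⊕_  : MPoly n → MPoly n → MPoly n
  _⊗_  : MPoly n → MPoly n → MPoly n

eval : {n : ℕ} → MPoly n → (Fin n → ℚ) → ℚ
eval (con c) y = c
eval (var v) y = y v
eval (p ⊕ q) y = eval p y + eval q y
eval (p ⊗ q) y = eval p y * eval q y

-- Expanding in μ = λ + 2 gives g = Σ_j (-1)^j (j + 1) e_j μ^(k-j), so ξ_i is (-1)^i (i + 1) e_i plus a
-- fixed linear combination of e_0, …, e_(i-1).  Newton's identities write e_i as ((-1)^(i-1) / i) p_i plus a
-- polynomial in p_1, …, p_(i-1); this gives F^(i), with c_i = -(i + 1) / i.  Uniqueness is the algebraic
-- independence of p_1, …, p_i for i ≤ k.  Newton's identities turn it into the independence of e_1, …, e_i,
-- which follows by induction on the number of variables: the top function e_i vanishes when a coordinate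
-- does, and a polynomial vanishing at all points with positive coordinates vanishes everywhere.

module Submission where

open import Defs
open import Data.Nat using (ℕ; zero; suc; z≤n; s≤s; _≤_; _<_; _∸_)
import Data.Nat.Properties as ℕ
open import Data.Fin using (Fin; zero; suc; toℕ; fromℕ; inject₁; opposite)
open import Data.Fin.Properties using (toℕ-fromℕ; toℕ-inject₁; toℕ<n; opposite-prop; opposite-involutive)
open import Data.List using (List; []; _∷_; map; length; replicate)
open import Data.List.Properties using (length-tabulate)
open import Data.Vec using (Vec)
import Data.Vec as Vec
open import Data.Vec.Properties using (length-toList)
open import Data.Vec.Functional using (head; tail; toList) renaming (_∷_ to _∷ᶠ_)
open import Data.Product using (Σ; _×_; _,_; proj₁; proj₂)
open import Data.Sum using (inj₁; inj₂)
open import Data.Rational using (ℚ; 0ℚ; 1ℚ; _+_; _*_; _-_; -_; 1/_; ≢-nonZero; NonZero)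
import Data.Rational as ℚ
open import Data.Rational.Properties
open import Function using (_∘_)
open import Level using (0ℓ)
open import Relation.Binary.PropositionalEquality
open import Relation.Nullary.Decidable using (dec⇒maybe)
open import Tactic.RingSolver using (solve-∀)
open import Tactic.RingSolver.Core.AlmostCommutativeRing using (AlmostCommutativeRing; fromCommutativeRing)

ℚ-ring : AlmostCommutativeRing 0ℓ 0ℓ
ℚ-ring = fromCommutativeRing +-*-commutativeRing (λ x → dec⇒maybe (0ℚ ≟ x))

x*y≡0⇒y≡0 : ∀ {x y} → x ≢ 0ℚ → x * y ≡ 0ℚ → y ≡ 0ℚ
x*y≡0⇒y≡0 {x} {y} x≢0 xy≡0 = begin
  y                ≡⟨ sym (*-identityˡ y) ⟩
  1ℚ * y           ≡⟨ cong (_* y) (sym (*-inverseˡ x)) ⟩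
  (1/ x) * x * y   ≡⟨ *-assoc (1/ x) x y ⟩
  (1/ x) * (x * y) ≡⟨ cong ((1/ x) *_) xy≡0 ⟩
  (1/ x) * 0ℚ      ≡⟨ *-zeroʳ (1/ x) ⟩
  0ℚ               ∎
  where
  open ≡-Reasoning
  instance
    x-nonZero : NonZero x
    x-nonZero = ≢-nonZero x≢0

x*y≢0 : ∀ {x y} → x ≢ 0ℚ → y ≢ 0ℚ → x * y ≢ 0ℚ
x*y≢0 x≢0 y≢0 xy≡0 = y≢0 (x*y≡0⇒y≡0 x≢0 xy≡0)

x-y≡0⇒x≡y : ∀ {x y} → x - y ≡ 0ℚ → x ≡ y
x-y≡0⇒x≡y {x} {y} x-y≡0 = begin
  x           ≡⟨ identity x y ⟩
  (x - y) + y ≡⟨ cong (_+ y) x-y≡0 ⟩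
  0ℚ + y      ≡⟨ +-identityˡ y ⟩
  y           ∎
  where
  open ≡-Reasoning
  identity : ∀ x y → x ≡ (x - y) + y
  identity = solve-∀ ℚ-ring

x+-1*y≡0⇒x≡y : ∀ {x y} → x + - 1ℚ * y ≡ 0ℚ → x ≡ y
x+-1*y≡0⇒x≡y {x} {y} eq = x-y≡0⇒x≡y (trans (identity x y) eq)
  where
  identity : ∀ x y → x - y ≡ x + - 1ℚ * y
  identity = solve-∀ ℚ-ring

x+-1*x≡0 : ∀ x → x + - 1ℚ * x ≡ 0ℚ
x+-1*x≡0 = solve-∀ ℚ-ring

x+0*y≡x : ∀ x y → x + 0ℚ * y ≡ x
x+0*y≡x x y = trans (cong (x +_) (*-zeroˡ y)) (+-identityʳ x)

x+y*0≡x : ∀ x y → x + y * 0ℚ ≡ x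
x+y*0≡x x y = trans (cong (x +_) (*-zeroʳ y)) (+-identityʳ x)

>0⇒≢0 : ∀ {x} → 0ℚ ℚ.< x → x ≢ 0ℚ
>0⇒≢0 0<x x≡0 = <-irrefl (sym x≡0) 0<x

x<x+1 : ∀ x → x ℚ.< x + 1ℚ
x<x+1 x = subst (ℚ._< x + 1ℚ) (+-identityʳ x) (+-monoʳ-< x (positive⁻¹ 1ℚ))

natℚ : ℕ → ℚ
natℚ zero    = 0ℚ
natℚ (suc n) = 1ℚ + natℚ n

natℚ-suc>0 : ∀ n → 0ℚ ℚ.< natℚ (suc n)
natℚ-suc>0 zero    = subst (0ℚ ℚ.<_) (sym (+-identityʳ 1ℚ)) (positive⁻¹ 1ℚ)
natℚ-suc>0 (suc n) = <-trans (natℚ-suc>0 n) (subst (natℚ (suc n) ℚ.<_) (+-comm (natℚ (suc n)) 1ℚ) (x<x+1 (natℚ (suc n))))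

1/[1+_] : ℕ → ℚ
1/[1+ n ] = (1/ natℚ (suc n)) {{≢-nonZero (>0⇒≢0 (natℚ-suc>0 n))}}

1/[1+n]*[1+n]≡1 : ∀ n → 1/[1+ n ] * natℚ (suc n) ≡ 1ℚ
1/[1+n]*[1+n]≡1 n = *-inverseˡ (natℚ (suc n)) {{≢-nonZero (>0⇒≢0 (natℚ-suc>0 n))}}

1/[1+n]≢0 : ∀ n → 1/[1+ n ] ≢ 0ℚ
1/[1+n]≢0 n eq = 1≢0 (begin
  1ℚ                        ≡⟨ sym (1/[1+n]*[1+n]≡1 n) ⟩
  1/[1+ n ] * natℚ (suc n)  ≡⟨ cong (_* natℚ (suc n)) eq ⟩
  0ℚ * natℚ (suc n)         ≡⟨ *-zeroˡ (natℚ (suc n)) ⟩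
  0ℚ                        ∎)
  where open ≡-Reasoning

[1+n]*x≡y⇒x≡y/[1+n] : ∀ n {x y} → natℚ (suc n) * x ≡ y → x ≡ 1/[1+ n ] * y
[1+n]*x≡y⇒x≡y/[1+n] n {x} {y} eq = begin
  x                                  ≡⟨ sym (*-identityˡ x) ⟩
  1ℚ * x                             ≡⟨ cong (_* x) (sym (1/[1+n]*[1+n]≡1 n)) ⟩
  1/[1+ n ] * natℚ (suc n) * x       ≡⟨ *-assoc 1/[1+ n ] (natℚ (suc n)) x ⟩
  1/[1+ n ] * (natℚ (suc n) * x)     ≡⟨ cong (1/[1+ n ] *_) eq ⟩
  1/[1+ n ] * y                      ∎
  where open ≡-Reasoning

[1+n]*[x/[1+n]]≡x : ∀ n x → natℚ (suc n) * (1/[1+ n ] * x) ≡ x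
[1+n]*[x/[1+n]]≡x n x = begin
  natℚ (suc n) * (1/[1+ n ] * x)   ≡⟨ sym (*-assoc (natℚ (suc n)) 1/[1+ n ] x) ⟩
  natℚ (suc n) * 1/[1+ n ] * x     ≡⟨ cong (_* x) (*-comm (natℚ (suc n)) 1/[1+ n ]) ⟩
  1/[1+ n ] * natℚ (suc n) * x     ≡⟨ cong (_* x) (1/[1+n]*[1+n]≡1 n) ⟩
  1ℚ * x                           ≡⟨ *-identityˡ x ⟩
  x                                ∎
  where open ≡-Reasoning

sgn : ℕ → ℚ
sgn zero    = 1ℚ
sgn (suc n) = - sgn n

sgn*sgn≡1 : ∀ n → sgn n * sgn n ≡ 1ℚ
sgn*sgn≡1 zero    = refl
sgn*sgn≡1 (suc n) = trans (neg*neg (sgn n)) (sgn*sgn≡1 n)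
  where
  neg*neg : ∀ x → - x * - x ≡ x * x
  neg*neg = solve-∀ ℚ-ring

sgn≢0 : ∀ n → sgn n ≢ 0ℚ
sgn≢0 n eq = 1≢0 (trans (sym (sgn*sgn≡1 n)) (trans (cong (_* sgn n) eq) (*-zeroˡ (sgn n))))

evalU : UPoly → ℚ → ℚ
evalU []      t = 0ℚ
evalU (a ∷ p) t = a + t * evalU p t

evalU-+P : ∀ p q t → evalU (p +P q) t ≡ evalU p t + evalU q t
evalU-+P []      q       t = sym (+-identityˡ _)
evalU-+P (a ∷ p) []      t = sym (+-identityʳ _)
evalU-+P (a ∷ p) (b ∷ q) t =
  trans (cong (λ r → a + b + t * r) (evalU-+P p q t)) (identity a b t (evalU p t) (evalU q t))
  where
  identity : ∀ a b t x y → a + b + t * (x + y) ≡ (a + t * x) + (b + t * y)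
  identity = solve-∀ ℚ-ring

evalU-scaleP : ∀ c p t → evalU (scaleP c p) t ≡ c * evalU p t
evalU-scaleP c []      t = sym (*-zeroʳ c)
evalU-scaleP c (a ∷ p) t =
  trans (cong (λ r → c * a + t * r) (evalU-scaleP c p t)) (identity c a t (evalU p t))
  where
  identity : ∀ c a t x → c * a + t * (c * x) ≡ c * (a + t * x)
  identity = solve-∀ ℚ-ring

evalU-*P : ∀ p q t → evalU (p *P q) t ≡ evalU p t * evalU q t
evalU-*P []      q t = sym (*-zeroˡ (evalU q t))
evalU-*P (a ∷ p) q t = begin
  evalU (scaleP a q +P (0ℚ ∷ p *P q)) t          ≡⟨ evalU-+P (scaleP a q) (0ℚ ∷ p *P q) t ⟩
  evalU (scaleP a q) t + (0ℚ + t * evalU (p *P q) t)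
    ≡⟨ cong₂ (λ x y → x + (0ℚ + t * y)) (evalU-scaleP a q t) (evalU-*P p q t) ⟩
  a * evalU q t + (0ℚ + t * (evalU p t * evalU q t)) ≡⟨ identity a t (evalU p t) (evalU q t) ⟩
  (a + t * evalU p t) * evalU q t                    ∎
  where
  open ≡-Reasoning
  identity : ∀ a t x y → a * y + (0ℚ + t * (x * y)) ≡ (a + t * x) * y
  identity = solve-∀ ℚ-ring

coeff-+P : ∀ p q d → coeff (p +P q) d ≡ coeff p d + coeff q d
coeff-+P []      q       d       = sym (+-identityˡ _)
coeff-+P (a ∷ p) []      d       = sym (+-identityʳ _)
coeff-+P (a ∷ p) (b ∷ q) zero    = refl
coeff-+P (a ∷ p) (b ∷ q) (suc d) = coeff-+P p q d

coeff-scaleP : ∀ c p d → coeff (scaleP c p) d ≡ c * coeff p d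
coeff-scaleP c []      d       = sym (*-zeroʳ c)
coeff-scaleP c (a ∷ p) zero    = refl
coeff-scaleP c (a ∷ p) (suc d) = coeff-scaleP c p d

-- synthetic division by X - r
quotient : UPoly → ℚ → UPoly
quotient []          r = []
quotient (a ∷ [])    r = []
quotient (a ∷ b ∷ p) r = evalU (b ∷ p) r ∷ quotient (b ∷ p) r

length-quotient : ∀ a p r → length (quotient (a ∷ p) r) ≡ length p
length-quotient a []      r = refl
length-quotient a (b ∷ p) r = cong suc (length-quotient b p r)

remainder-theorem : ∀ p r t → evalU p t ≡ (t - r) * evalU (quotient p r) t + evalU p r
remainder-theorem []          r t = sym (identity t r)
  where
  identity : ∀ t r → (t - r) * 0ℚ + 0ℚ ≡ 0ℚ
  identity = solve-∀ ℚ-ring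
remainder-theorem (a ∷ [])    r t = identity a t r
  where
  identity : ∀ a t r → a + t * 0ℚ ≡ (t - r) * 0ℚ + (a + r * 0ℚ)
  identity = solve-∀ ℚ-ring
remainder-theorem (a ∷ b ∷ p) r t =
  trans (cong (λ x → a + t * x) (remainder-theorem (b ∷ p) r t))
        (identity a t r (evalU (quotient (b ∷ p) r) t) (evalU (b ∷ p) r))
  where
  identity : ∀ a t r q s → a + t * ((t - r) * q + s) ≡ (t - r) * (s + t * q) + (a + r * s)
  identity = solve-∀ ℚ-ring

-- Induction on the length, since the quotient is not a subterm: peel off a root r above the
-- current bound and raise the bound to r.
vanishes-above⇒vanishes : ∀ {n} p → length p ≡ n → (b : ℚ) →
                          (∀ t → b ℚ.< t → evalU p t ≡ 0ℚ) → ∀ t → evalU p t ≡ 0ℚ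
vanishes-above⇒vanishes         []      _   b vanish t = refl
vanishes-above⇒vanishes {suc n} (a ∷ p) len b vanish t = begin
  evalU (a ∷ p) t                        ≡⟨ remainder-theorem (a ∷ p) r t ⟩
  (t - r) * evalU q t + evalU (a ∷ p) r  ≡⟨ cong₂ (λ x y → (t - r) * x + y) (q-vanishes t) (vanish r b<r) ⟩
  (t - r) * 0ℚ + 0ℚ                      ≡⟨ identity t r ⟩
  0ℚ                                     ∎
  where
  open ≡-Reasoning
  r = b + 1ℚ
  b<r = x<x+1 b
  q = quotient (a ∷ p) r
  identity : ∀ t r → (t - r) * 0ℚ + 0ℚ ≡ 0ℚ
  identity = solve-∀ ℚ-ring
  q-vanishes-above : ∀ s → r ℚ.< s → evalU q s ≡ 0ℚ
  q-vanishes-above s r<s = x*y≡0⇒y≡0 (λ s-r≡0 → <-irrefl (sym (x-y≡0⇒x≡y s-r≡0)) r<s) (begin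
    (s - r) * evalU q s                     ≡⟨ sym (+-identityʳ _) ⟩
    (s - r) * evalU q s + 0ℚ                ≡⟨ cong ((s - r) * evalU q s +_) (sym (vanish r b<r)) ⟩
    (s - r) * evalU q s + evalU (a ∷ p) r   ≡⟨ sym (remainder-theorem (a ∷ p) r s) ⟩
    evalU (a ∷ p) s                         ≡⟨ vanish s (<-trans b<r r<s) ⟩
    0ℚ                                      ∎)
  q-vanishes : ∀ t → evalU q t ≡ 0ℚ
  q-vanishes = vanishes-above⇒vanishes q (trans (length-quotient a p r) (ℕ.suc-injective len)) r q-vanishes-above

vanishes⇒coeff≡0 : ∀ p → (∀ t → evalU p t ≡ 0ℚ) → ∀ d → coeff p d ≡ 0ℚ
vanishes⇒coeff≡0 []      vanish d = refl
vanishes⇒coeff≡0 (a ∷ p) vanish d = coeff-vanishes d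
  where
  a≡0 : a ≡ 0ℚ
  a≡0 = trans (sym (x+0*y≡x a (evalU p 0ℚ))) (vanish 0ℚ)
  t*p≡0 : ∀ t → t * evalU p t ≡ 0ℚ
  t*p≡0 t = trans (sym (+-identityˡ _)) (trans (cong (_+ t * evalU p t) (sym a≡0)) (vanish t))
  p-vanishes : ∀ t → evalU p t ≡ 0ℚ
  p-vanishes = vanishes-above⇒vanishes p refl 0ℚ (λ t 0<t → x*y≡0⇒y≡0 (>0⇒≢0 0<t) (t*p≡0 t))
  coeff-vanishes : ∀ d → coeff (a ∷ p) d ≡ 0ℚ
  coeff-vanishes zero    = a≡0
  coeff-vanishes (suc d) = vanishes⇒coeff≡0 p p-vanishes d

coeff-unique : ∀ p q → (∀ t → evalU p t ≡ evalU q t) → ∀ d → coeff p d ≡ coeff q d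
coeff-unique p q p≗q d = x+-1*y≡0⇒x≡y (begin
  coeff p d + - 1ℚ * coeff q d          ≡⟨ cong (coeff p d +_) (sym (coeff-scaleP (- 1ℚ) q d)) ⟩
  coeff p d + coeff (scaleP (- 1ℚ) q) d ≡⟨ sym (coeff-+P p (scaleP (- 1ℚ) q) d) ⟩
  coeff (p +P scaleP (- 1ℚ) q) d        ≡⟨ vanishes⇒coeff≡0 (p +P scaleP (- 1ℚ) q) difference-vanishes d ⟩
  0ℚ                                    ∎)
  where
  open ≡-Reasoning
  difference-vanishes : ∀ t → evalU (p +P scaleP (- 1ℚ) q) t ≡ 0ℚ
  difference-vanishes t = begin
    evalU (p +P scaleP (- 1ℚ) q) t            ≡⟨ evalU-+P p (scaleP (- 1ℚ) q) t ⟩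
    evalU p t + evalU (scaleP (- 1ℚ) q) t     ≡⟨ cong₂ _+_ (p≗q t) (evalU-scaleP (- 1ℚ) q t) ⟩
    evalU q t + - 1ℚ * evalU q t              ≡⟨ x+-1*x≡0 (evalU q t) ⟩
    0ℚ                                        ∎

eval-cong : ∀ {n} (p : MPoly n) {y y′ : Fin n → ℚ} → y ≗ y′ → eval p y ≡ eval p y′
eval-cong (con c) y≗y′ = refl
eval-cong (var i) y≗y′ = y≗y′ i
eval-cong (p ⊕ q) y≗y′ = cong₂ _+_ (eval-cong p y≗y′) (eval-cong q y≗y′)
eval-cong (p ⊗ q) y≗y′ = cong₂ _*_ (eval-cong p y≗y′) (eval-cong q y≗y′)

head∷tail : ∀ {n} (x : Fin (suc n) → ℚ) → x ≗ head x ∷ᶠ tail x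
head∷tail x zero    = refl
head∷tail x (suc i) = refl

rename : ∀ {n m} → (Fin n → Fin m) → MPoly n → MPoly m
rename f (con c) = con c
rename f (var i) = var (f i)
rename f (p ⊕ q) = rename f p ⊕ rename f q
rename f (p ⊗ q) = rename f p ⊗ rename f q

eval-rename : ∀ {n m} (f : Fin n → Fin m) p (y : Fin m → ℚ) → eval (rename f p) y ≡ eval p (y ∘ f)
eval-rename f (con c) y = refl
eval-rename f (var i) y = refl
eval-rename f (p ⊕ q) y = cong₂ _+_ (eval-rename f p y) (eval-rename f q y)
eval-rename f (p ⊗ q) y = cong₂ _*_ (eval-rename f p y) (eval-rename f q y)

substitute : ∀ {n m} → MPoly n → (Fin n → MPoly m) → MPoly m
substitute (con c) σ = con c
substitute (var i) σ = σ i
substitute (p ⊕ q) σ = substitute p σ ⊕ substitute q σ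
substitute (p ⊗ q) σ = substitute p σ ⊗ substitute q σ

eval-substitute : ∀ {n m} p (σ : Fin n → MPoly m) (y : Fin m → ℚ) →
                  eval (substitute p σ) y ≡ eval p (λ i → eval (σ i) y)
eval-substitute (con c) σ y = refl
eval-substitute (var i) σ y = refl
eval-substitute (p ⊕ q) σ y = cong₂ _+_ (eval-substitute p σ y) (eval-substitute q σ y)
eval-substitute (p ⊗ q) σ y = cong₂ _*_ (eval-substitute p σ y) (eval-substitute q σ y)

-- Polynomials in the head variable whose coefficients are polynomials in the remaining ones.

infixl 6 _+C_
infixl 7 _*C_

_+C_ : ∀ {n} → List (MPoly n) → List (MPoly n) → List (MPoly n)
[]      +C q       = q
(a ∷ p) +C []      = a ∷ p
(a ∷ p) +C (b ∷ q) = (a ⊕ b) ∷ (p +C q)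

_*C_ : ∀ {n} → List (MPoly n) → List (MPoly n) → List (MPoly n)
[]      *C q = []
(a ∷ p) *C q = map (a ⊗_) q +C (con 0ℚ ∷ p *C q)

evalC : ∀ {n} → (Fin n → ℚ) → List (MPoly n) → UPoly
evalC w = map (λ c → eval c w)

evalC-+C : ∀ {n} (w : Fin n → ℚ) p q → evalC w (p +C q) ≡ evalC w p +P evalC w q
evalC-+C w []      q       = refl
evalC-+C w (a ∷ p) []      = refl
evalC-+C w (a ∷ p) (b ∷ q) = cong (_ ∷_) (evalC-+C w p q)

evalC-scale : ∀ {n} (w : Fin n → ℚ) a q → evalC w (map (a ⊗_) q) ≡ scaleP (eval a w) (evalC w q)
evalC-scale w a []      = refl
evalC-scale w a (b ∷ q) = cong (_ ∷_) (evalC-scale w a q)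

evalC-*C : ∀ {n} (w : Fin n → ℚ) p q → evalC w (p *C q) ≡ evalC w p *P evalC w q
evalC-*C w []      q = refl
evalC-*C w (a ∷ p) q = trans (evalC-+C w (map (a ⊗_) q) (con 0ℚ ∷ p *C q))
  (cong₂ _+P_ (evalC-scale w a q) (cong (0ℚ ∷_) (evalC-*C w p q)))

coefficients : ∀ {n} → MPoly (suc n) → List (MPoly n)
coefficients (con c)       = con c ∷ []
coefficients (var zero)    = con 0ℚ ∷ con 1ℚ ∷ []
coefficients (var (suc i)) = var i ∷ []
coefficients (p ⊕ q)       = coefficients p +C coefficients q
coefficients (p ⊗ q)       = coefficients p *C coefficients q

evalU-coefficients : ∀ {n} p (w : Fin n → ℚ) t → evalU (evalC w (coefficients p)) t ≡ eval p (t ∷ᶠ w)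
evalU-coefficients (con c)       w t = x+y*0≡x c t
evalU-coefficients (var zero)    w t = linear t
  where
  linear : ∀ t → 0ℚ + t * (1ℚ + t * 0ℚ) ≡ t
  linear = solve-∀ ℚ-ring
evalU-coefficients (var (suc i)) w t = x+y*0≡x (w i) t
evalU-coefficients (p ⊕ q) w t = begin
  evalU (evalC w (coefficients p +C coefficients q)) t
    ≡⟨ cong (λ r → evalU r t) (evalC-+C w (coefficients p) (coefficients q)) ⟩
  evalU (evalC w (coefficients p) +P evalC w (coefficients q)) t
    ≡⟨ evalU-+P (evalC w (coefficients p)) (evalC w (coefficients q)) t ⟩
  evalU (evalC w (coefficients p)) t + evalU (evalC w (coefficients q)) t
    ≡⟨ cong₂ _+_ (evalU-coefficients p w t) (evalU-coefficients q w t) ⟩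
  eval p (t ∷ᶠ w) + eval q (t ∷ᶠ w) ∎
  where open ≡-Reasoning
evalU-coefficients (p ⊗ q) w t = begin
  evalU (evalC w (coefficients p *C coefficients q)) t
    ≡⟨ cong (λ r → evalU r t) (evalC-*C w (coefficients p) (coefficients q)) ⟩
  evalU (evalC w (coefficients p) *P evalC w (coefficients q)) t
    ≡⟨ evalU-*P (evalC w (coefficients p)) (evalC w (coefficients q)) t ⟩
  evalU (evalC w (coefficients p)) t * evalU (evalC w (coefficients q)) t
    ≡⟨ cong₂ _*_ (evalU-coefficients p w t) (evalU-coefficients q w t) ⟩
  eval p (t ∷ᶠ w) * eval q (t ∷ᶠ w) ∎
  where open ≡-Reasoning

horner : ∀ {n} → List (MPoly n) → MPoly (suc n)
horner []       = con 0ℚ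
horner (c ∷ cs) = rename suc c ⊕ (var zero ⊗ horner cs)

eval-horner-∷ : ∀ {n} c cs (z : Fin (suc n) → ℚ) →
                eval (horner (c ∷ cs)) z ≡ eval c (tail z) + head z * eval (horner cs) z
eval-horner-∷ c cs z = cong (_+ head z * eval (horner cs) z) (eval-rename suc c z)

eval-horner : ∀ {n} cs (w : Fin n → ℚ) t → eval (horner cs) (t ∷ᶠ w) ≡ evalU (evalC w cs) t
eval-horner []       w t = refl
eval-horner (c ∷ cs) w t = trans (eval-horner-∷ c cs (t ∷ᶠ w)) (cong (λ x → eval c w + t * x) (eval-horner cs w t))

eval-horner-coefficients : ∀ {n} p (z : Fin (suc n) → ℚ) → eval (horner (coefficients p)) z ≡ eval p z
eval-horner-coefficients p z = begin
  eval (horner (coefficients p)) z                ≡⟨ eval-cong (horner (coefficients p)) (head∷tail z) ⟩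
  eval (horner (coefficients p)) (head z ∷ᶠ tail z) ≡⟨ eval-horner (coefficients p) (tail z) (head z) ⟩
  evalU (evalC (tail z) (coefficients p)) (head z) ≡⟨ evalU-coefficients p (tail z) (head z) ⟩
  eval p (head z ∷ᶠ tail z)                       ≡⟨ eval-cong p (λ i → sym (head∷tail z i)) ⟩
  eval p z                                        ∎
  where open ≡-Reasoning

fix-head : ∀ {n} → MPoly (suc n) → ℚ → MPoly n
fix-head p t = substitute p (con t ∷ᶠ var)

eval-fix-head : ∀ {n} p t (w : Fin n → ℚ) → eval (fix-head p t) w ≡ eval p (t ∷ᶠ w)
eval-fix-head p t w = trans (eval-substitute p (con t ∷ᶠ var) w) (eval-cong p λ { zero → refl ; (suc i) → refl })

AllPositive : ∀ {n} → (Fin n → ℚ) → Set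
AllPositive x = ∀ i → 0ℚ ℚ.< x i

vanishes-on-positive⇒vanishes : ∀ {n} (p : MPoly n) → (∀ x → AllPositive x → eval p x ≡ 0ℚ) → ∀ x → eval p x ≡ 0ℚ
vanishes-on-positive⇒vanishes {zero}  p vanish x = trans (eval-cong p (λ ())) (vanish x (λ ()))
vanishes-on-positive⇒vanishes {suc n} p vanish x =
  trans (eval-cong p (head∷tail x)) (vanishes-everywhere (head x) (tail x))
  where
  vanishes-on-positive-tail : ∀ w → AllPositive w → ∀ t → eval p (t ∷ᶠ w) ≡ 0ℚ
  vanishes-on-positive-tail w w>0 t = trans (sym (evalU-coefficients p w t))
    (vanishes-above⇒vanishes (evalC w (coefficients p)) refl 0ℚ
      (λ s s>0 → trans (evalU-coefficients p w s) (vanish (s ∷ᶠ w) λ { zero → s>0 ; (suc i) → w>0 i })) t)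
  vanishes-everywhere : ∀ t w → eval p (t ∷ᶠ w) ≡ 0ℚ
  vanishes-everywhere t w = trans (sym (eval-fix-head p t w))
    (vanishes-on-positive⇒vanishes (fix-head p t)
      (λ w′ w′>0 → trans (eval-fix-head p t w′) (vanishes-on-positive-tail w′ w′>0 t)) w)

-- junk (con 0ℚ) when n ≤ t
varAt : ∀ {n} → ℕ → MPoly n
varAt {zero}  t       = con 0ℚ
varAt {suc n} zero    = var zero
varAt {suc n} (suc t) = rename suc (varAt t)

eval-varAt : ∀ {n} (g : ℕ → ℚ) t → t < n → eval (varAt t) (λ (i : Fin n) → g (toℕ i)) ≡ g t
eval-varAt {suc n} g zero    _         = refl
eval-varAt {suc n} g (suc t) (s≤s t<n) = trans (eval-rename suc (varAt {n} t) (λ i → g (toℕ i))) (eval-varAt (g ∘ suc) t t<n)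

eval-varAt-toℕ : ∀ {n} (i : Fin n) (w : Fin n → ℚ) → eval (varAt (toℕ i)) w ≡ w i
eval-varAt-toℕ zero    w = refl
eval-varAt-toℕ (suc i) w = trans (eval-rename suc (varAt (toℕ i)) w) (eval-varAt-toℕ i (tail w))

∑ : ℕ → (ℕ → ℚ) → ℚ
∑ zero    f = 0ℚ
∑ (suc n) f = f 0 + ∑ n (λ j → f (suc j))

syntax ∑ n (λ j → e) = ∑[ j < n ] e

∑-cong : ∀ n {f g : ℕ → ℚ} → (∀ j → j < n → f j ≡ g j) → ∑ n f ≡ ∑ n g
∑-cong zero    f≗g = refl
∑-cong (suc n) f≗g = cong₂ _+_ (f≗g 0 (s≤s z≤n)) (∑-cong n (λ j j<n → f≗g (suc j) (s≤s j<n)))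

∑-distrib-+ : ∀ n (f g : ℕ → ℚ) → ∑[ j < n ] (f j + g j) ≡ ∑ n f + ∑ n g
∑-distrib-+ zero    f g = sym (+-identityˡ 0ℚ)
∑-distrib-+ (suc n) f g =
  trans (cong (f 0 + g 0 +_) (∑-distrib-+ n (f ∘ suc) (g ∘ suc))) (identity (f 0) (g 0) (∑ n (f ∘ suc)) (∑ n (g ∘ suc)))
  where
  identity : ∀ a b x y → (a + b) + (x + y) ≡ (a + x) + (b + y)
  identity = solve-∀ ℚ-ring

*-distribˡ-∑ : ∀ n c (f : ℕ → ℚ) → ∑[ j < n ] (c * f j) ≡ c * ∑ n f
*-distribˡ-∑ zero    c f = sym (*-zeroʳ c)
*-distribˡ-∑ (suc n) c f = trans (cong (c * f 0 +_) (*-distribˡ-∑ n c (f ∘ suc))) (sym (*-distribˡ-+ c (f 0) (∑ n (f ∘ suc))))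

∑-last : ∀ n (f : ℕ → ℚ) → ∑ (suc n) f ≡ ∑ n f + f n
∑-last zero    f = trans (+-identityʳ (f 0)) (sym (+-identityˡ (f 0)))
∑-last (suc n) f = trans (cong (f 0 +_) (∑-last n (f ∘ suc))) (sym (+-assoc (f 0) (∑ n (f ∘ suc)) (f (suc n))))

∑-vanishing-tail : ∀ n i (f : ℕ → ℚ) → i < n → (∀ j → i < j → j < n → f j ≡ 0ℚ) → ∑ n f ≡ ∑ i f + f i
∑-vanishing-tail (suc n) i f (s≤s i≤n) tail≡0 with ℕ.m≤n⇒m<n∨m≡n i≤n
... | inj₂ refl = ∑-last i f
... | inj₁ i<n  = begin
  ∑ (suc n) f         ≡⟨ ∑-last n f ⟩
  ∑ n f + f n
    ≡⟨ cong₂ _+_ (∑-vanishing-tail n i f i<n (λ j i<j j<n → tail≡0 j i<j (ℕ.m≤n⇒m≤1+n j<n)))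
                 (tail≡0 n i<n ℕ.≤-refl) ⟩
  (∑ i f + f i) + 0ℚ  ≡⟨ +-identityʳ _ ⟩
  ∑ i f + f i         ∎
  where open ≡-Reasoning

∑P : ℕ → (ℕ → UPoly) → UPoly
∑P zero    F = []
∑P (suc n) F = F 0 +P ∑P n (F ∘ suc)

evalU-∑P : ∀ n F t → evalU (∑P n F) t ≡ ∑[ j < n ] evalU (F j) t
evalU-∑P zero    F t = refl
evalU-∑P (suc n) F t = trans (evalU-+P (F 0) (∑P n (F ∘ suc)) t) (cong (evalU (F 0) t +_) (evalU-∑P n (F ∘ suc) t))

coeff-∑P : ∀ n F d → coeff (∑P n F) d ≡ ∑[ j < n ] coeff (F j) d
coeff-∑P zero    F d = refl
coeff-∑P (suc n) F d = trans (coeff-+P (F 0) (∑P n (F ∘ suc)) d) (cong (coeff (F 0) d +_) (coeff-∑P n (F ∘ suc) d))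

∑M : ∀ {n} → ℕ → (ℕ → MPoly n) → MPoly n
∑M zero    F = con 0ℚ
∑M (suc j) F = F 0 ⊕ ∑M j (F ∘ suc)

eval-∑M : ∀ {n} j (F : ℕ → MPoly n) w → eval (∑M j F) w ≡ ∑[ s < j ] eval (F s) w
eval-∑M zero    F w = refl
eval-∑M (suc j) F w = cong (eval (F 0) w +_) (eval-∑M j (F ∘ suc) w)

-- Convolution and Newton's identities

-- conv f g n = Σ_{t ≤ n} f t * g (n - t)
conv : (ℕ → ℚ) → (ℕ → ℚ) → ℕ → ℚ
conv f g zero    = f 0 * g 0
conv f g (suc n) = f 0 * g (suc n) + conv (λ t → f (suc t)) g n

conv-cong : ∀ n {f f′ g g′ : ℕ → ℚ} → (∀ t → t ≤ n → f t ≡ f′ t) → (∀ t → t ≤ n → g t ≡ g′ t) →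
            conv f g n ≡ conv f′ g′ n
conv-cong zero    f≗f′ g≗g′ = cong₂ _*_ (f≗f′ 0 z≤n) (g≗g′ 0 z≤n)
conv-cong (suc n) f≗f′ g≗g′ = cong₂ _+_ (cong₂ _*_ (f≗f′ 0 z≤n) (g≗g′ (suc n) ℕ.≤-refl))
  (conv-cong n (λ t t≤n → f≗f′ (suc t) (s≤s t≤n)) (λ t t≤n → g≗g′ t (ℕ.m≤n⇒m≤1+n t≤n)))

conv-+ˡ : ∀ n (f f′ g : ℕ → ℚ) → conv (λ t → f t + f′ t) g n ≡ conv f g n + conv f′ g n
conv-+ˡ zero    f f′ g = *-distribʳ-+ (g 0) (f 0) (f′ 0)
conv-+ˡ (suc n) f f′ g =
  trans (cong ((f 0 + f′ 0) * g (suc n) +_) (conv-+ˡ n (λ t → f (suc t)) (λ t → f′ (suc t)) g))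
        (identity (f 0) (f′ 0) (g (suc n)) _ _)
  where
  identity : ∀ a b c x y → (a + b) * c + (x + y) ≡ (a * c + x) + (b * c + y)
  identity = solve-∀ ℚ-ring

conv-+ʳ : ∀ n (f g g′ : ℕ → ℚ) → conv f (λ t → g t + g′ t) n ≡ conv f g n + conv f g′ n
conv-+ʳ zero    f g g′ = *-distribˡ-+ (f 0) (g 0) (g′ 0)
conv-+ʳ (suc n) f g g′ =
  trans (cong (f 0 * (g (suc n) + g′ (suc n)) +_) (conv-+ʳ n (λ t → f (suc t)) g g′))
        (identity (f 0) (g (suc n)) (g′ (suc n)) _ _)
  where
  identity : ∀ a b c x y → a * (b + c) + (x + y) ≡ (a * b + x) + (a * c + y)
  identity = solve-∀ ℚ-ring

conv-*ˡ : ∀ n c (f g : ℕ → ℚ) → conv (λ t → c * f t) g n ≡ c * conv f g n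
conv-*ˡ zero    c f g = *-assoc c (f 0) (g 0)
conv-*ˡ (suc n) c f g =
  trans (cong (c * f 0 * g (suc n) +_) (conv-*ˡ n c (λ t → f (suc t)) g))
        (identity c (f 0) (g (suc n)) _)
  where
  identity : ∀ c a b x → c * a * b + c * x ≡ c * (a * b + x)
  identity = solve-∀ ℚ-ring

conv-*ʳ : ∀ n c (f g : ℕ → ℚ) → conv f (λ t → c * g t) n ≡ c * conv f g n
conv-*ʳ zero    c f g = identity c (f 0) (g 0)
  where
  identity : ∀ c a b → a * (c * b) ≡ c * (a * b)
  identity = solve-∀ ℚ-ring
conv-*ʳ (suc n) c f g =
  trans (cong (f 0 * (c * g (suc n)) +_) (conv-*ʳ n c (λ t → f (suc t)) g))
        (identity c (f 0) (g (suc n)) _)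
  where
  identity : ∀ c a b x → a * (c * b) + c * x ≡ c * (a * b + x)
  identity = solve-∀ ℚ-ring

conv-zeroˡ : ∀ n (f g : ℕ → ℚ) → (∀ t → f t ≡ 0ℚ) → conv f g n ≡ 0ℚ
conv-zeroˡ zero    f g f≡0 = trans (cong (_* g 0) (f≡0 0)) (*-zeroˡ (g 0))
conv-zeroˡ (suc n) f g f≡0 = trans
  (cong₂ _+_ (trans (cong (_* g (suc n)) (f≡0 0)) (*-zeroˡ (g (suc n))))
             (conv-zeroˡ n (λ t → f (suc t)) g (λ t → f≡0 (suc t))))
  (+-identityˡ 0ℚ)

shift : (ℕ → ℚ) → ℕ → ℚ
shift g zero    = 0ℚ
shift g (suc t) = g t

conv-shift-0 : ∀ (f g : ℕ → ℚ) → conv f (shift g) 0 ≡ 0ℚ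
conv-shift-0 f g = *-zeroʳ (f 0)

conv-shift : ∀ n (f g : ℕ → ℚ) → conv f (shift g) (suc n) ≡ conv f g n
conv-shift zero    f g = trans (cong (f 0 * g 0 +_) (*-zeroʳ (f 1))) (+-identityʳ _)
conv-shift (suc n) f g = cong (f 0 * g (suc n) +_) (conv-shift n (λ t → f (suc t)) g)

-- convInit f g n = Σ_{t < n} f t * g (n - t)
convInit : (ℕ → ℚ) → (ℕ → ℚ) → ℕ → ℚ
convInit f g zero    = 0ℚ
convInit f g (suc n) = conv f (λ s → g (suc s)) n

conv≡convInit+last : ∀ n (f g : ℕ → ℚ) → conv f g n ≡ convInit f g n + f n * g 0
conv≡convInit+last zero    f g = sym (+-identityˡ _)
conv≡convInit+last (suc n) f g = last n f g
  where
  last : ∀ n (f g : ℕ → ℚ) → conv f g (suc n) ≡ conv f (λ s → g (suc s)) n + f (suc n) * g 0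
  last zero    f g = refl
  last (suc n) f g = trans (cong (f 0 * g (suc (suc n)) +_) (last n (λ t → f (suc t)) g))
    (sym (+-assoc (f 0 * g (suc (suc n))) (conv (λ t → f (suc t)) (λ s → g (suc s)) n) (f (suc (suc n)) * g 0)))

convInit-cong : ∀ n {f f′ g g′ : ℕ → ℚ} → (∀ t → t < n → f t ≡ f′ t) → (∀ t → t ≤ n → g t ≡ g′ t) →
                convInit f g n ≡ convInit f′ g′ n
convInit-cong zero    f≗f′ g≗g′ = refl
convInit-cong (suc n) f≗f′ g≗g′ = conv-cong n (λ t t≤n → f≗f′ t (s≤s t≤n)) (λ t t≤n → g≗g′ (suc t) (s≤s t≤n))

alternating-telescope : ∀ x (u : ℕ → ℚ) j →
  conv (λ t → sgn t * pow x t) u j + x * conv (λ t → sgn t * pow x t) (shift u) j ≡ u j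
alternating-telescope x u zero = trans (cong (λ z → 1ℚ * 1ℚ * u 0 + x * z) (conv-shift-0 h u)) (identity (u 0) x)
  where
  h = λ t → sgn t * pow x t
  identity : ∀ a x → 1ℚ * 1ℚ * a + x * 0ℚ ≡ a
  identity = solve-∀ ℚ-ring
alternating-telescope x u (suc j) = begin
  (h 0 * u (suc j) + conv (λ t → h (suc t)) u j) + x * conv h (shift u) (suc j)
    ≡⟨ cong₂ (λ a b → (h 0 * u (suc j) + a) + x * b) h-suc (conv-shift j h u) ⟩
  (1ℚ * 1ℚ * u (suc j) + - x * conv h u j) + x * conv h u j
    ≡⟨ identity (u (suc j)) x (conv h u j) ⟩
  u (suc j) ∎
  where
  open ≡-Reasoning
  h = λ t → sgn t * pow x t
  identity : ∀ a x c → (1ℚ * 1ℚ * a + - x * c) + x * c ≡ a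
  identity = solve-∀ ℚ-ring
  step : ∀ s x w → - s * (x * w) ≡ - x * (s * w)
  step = solve-∀ ℚ-ring
  h-suc : conv (λ t → h (suc t)) u j ≡ - x * conv h u j
  h-suc = trans (conv-cong j (λ t _ → step (sgn t) x (pow x t)) (λ _ _ → refl)) (conv-*ˡ j (- x) h u)

esym : List ℚ → ℕ → ℚ
esym xs       zero    = 1ℚ
esym []       (suc j) = 0ℚ
esym (x ∷ xs) (suc j) = esym xs (suc j) + x * esym xs j

psum : List ℚ → ℕ → ℚ
psum xs t = sumQ (map (λ x → pow x t) xs)

-- Newton's identity  Σ_{t ≤ j} (-1)^t p_{t+1} u_{j-t} = (j + 1) u_{j+1},  with y t standing for p_{t+1}.
NewtonAt : (ℕ → ℚ) → (ℕ → ℚ) → ℕ → Set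
NewtonAt y u j = conv (λ t → sgn t * y t) u j ≡ natℚ (suc j) * u (suc j)

newton : ∀ xs j → NewtonAt (λ t → psum xs (suc t)) (esym xs) j
newton []       j = trans (conv-zeroˡ j _ (esym []) (λ t → *-zeroʳ (sgn t))) (sym (*-zeroʳ (natℚ (suc j))))
newton (x ∷ xs) j = begin
  conv (λ t → sgn t * psum (x ∷ xs) (suc t)) (esym (x ∷ xs)) j
    ≡⟨ conv-cong j (λ t _ → split-power (sgn t) x (pow x t) (psum xs (suc t))) e-∷ ⟩
  conv (λ t → f t + x * h t) (λ t → e t + x * shift e t) j
    ≡⟨ conv-+ˡ j f (λ t → x * h t) _ ⟩
  conv f (λ t → e t + x * shift e t) j + conv (λ t → x * h t) (λ t → e t + x * shift e t) j
    ≡⟨ cong₂ _+_ (trans (conv-+ʳ j f e _) (cong (conv f e j +_) (conv-*ʳ j x f (shift e))))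
                 (trans (conv-*ˡ j x h _) (cong (x *_) (trans (conv-+ʳ j h e _) (cong (conv h e j +_) (conv-*ʳ j x h (shift e)))))) ⟩
  (conv f e j + x * conv f (shift e) j) + x * (conv h e j + x * conv h (shift e) j)
    ≡⟨ cong₂ (λ a b → (a + x * conv f (shift e) j) + x * b) (newton xs j) (alternating-telescope x e j) ⟩
  (natℚ (suc j) * e (suc j) + x * conv f (shift e) j) + x * e j
    ≡⟨ cong (λ c → (natℚ (suc j) * e (suc j) + x * c) + x * e j) (shifted-newton j) ⟩
  (natℚ (suc j) * e (suc j) + x * (natℚ j * e j)) + x * e j
    ≡⟨ regroup (natℚ j) (e (suc j)) (e j) x ⟩
  natℚ (suc j) * esym (x ∷ xs) (suc j) ∎
  where
  open ≡-Reasoning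
  e = esym xs
  f = λ t → sgn t * psum xs (suc t)
  h = λ t → sgn t * pow x t
  split-power : ∀ s x w p → s * (x * w + p) ≡ s * p + x * (s * w)
  split-power = solve-∀ ℚ-ring
  regroup : ∀ n a b x → ((1ℚ + n) * a + x * (n * b)) + x * b ≡ (1ℚ + n) * (a + x * b)
  regroup = solve-∀ ℚ-ring
  e-∷ : ∀ t → t ≤ j → esym (x ∷ xs) t ≡ e t + x * shift e t
  e-∷ zero    _ = sym (x+y*0≡x 1ℚ x)
  e-∷ (suc t) _ = refl
  shifted-newton : ∀ j → conv f (shift e) j ≡ natℚ j * e j
  shifted-newton zero    = trans (conv-shift-0 f e) (sym (*-zeroˡ (e 0)))
  shifted-newton (suc j) = trans (conv-shift j f e) (newton xs j)

newton-solved : ∀ {y u : ℕ → ℚ} j → u 0 ≡ 1ℚ → NewtonAt y u j →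
                u (suc j) ≡ 1/[1+ j ] * (convInit (λ t → sgn t * y t) u j + sgn j * y j)
newton-solved {y} {u} j u0≡1 newtonAt = [1+n]*x≡y⇒x≡y/[1+n] j (begin
  natℚ (suc j) * u (suc j)                      ≡⟨ sym newtonAt ⟩
  conv (λ t → sgn t * y t) u j                  ≡⟨ conv≡convInit+last j _ u ⟩
  convInit (λ t → sgn t * y t) u j + sgn j * y j * u 0
    ≡⟨ cong (λ v → convInit (λ t → sgn t * y t) u j + sgn j * y j * v) u0≡1 ⟩
  convInit (λ t → sgn t * y t) u j + sgn j * y j * 1ℚ
    ≡⟨ cong (convInit (λ t → sgn t * y t) u j +_) (*-identityʳ (sgn j * y j)) ⟩
  convInit (λ t → sgn t * y t) u j + sgn j * y j ∎)
  where open ≡-Reasoning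

module CourseOfValues {A : Set} (z : A) (f : ℕ → (ℕ → A) → A) where

  -- table n s computes the value at s from the row table (n - 1); it is final once s ≤ n.
  table : ℕ → ℕ → A
  table n       zero    = z
  table zero    (suc s) = z
  table (suc n) (suc s) = f s (table n)

  cov : ℕ → A
  cov s = table s s

  cov-induction : (P : ℕ → A → Set) → P 0 z →
                  (∀ s g → (∀ t → t ≤ s → P t (g t)) → P (suc s) (f s g)) → ∀ s → P s (cov s)
  cov-induction P base step s = table-induction s s ℕ.≤-refl
    where
    table-induction : ∀ n s → s ≤ n → P s (table n s)
    table-induction n       zero    _         = base
    table-induction (suc n) (suc s) (s≤s s≤n) =
      step s (table n) (λ t t≤s → table-induction n t (ℕ.≤-trans t≤s s≤n))

  cov-suc : (∀ s {g h} → (∀ t → t ≤ s → g t ≡ h t) → f s g ≡ f s h) → ∀ s → cov (suc s) ≡ f s cov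
  cov-suc f-cong s = f-cong s (λ t t≤s → table-agree s t≤s t≤s ℕ.≤-refl)
    where
    table-agree : ∀ b {t n n′} → t ≤ b → t ≤ n → t ≤ n′ → table n t ≡ table n′ t
    table-agree b       {zero}                    _         _         _          = refl
    table-agree (suc b) {suc t} {suc n} {suc n′} (s≤s t≤b) (s≤s t≤n) (s≤s t≤n′) = f-cong t (λ r r≤t →
      table-agree b (ℕ.≤-trans r≤t t≤b) (ℕ.≤-trans r≤t t≤n) (ℕ.≤-trans r≤t t≤n′))

convP : ∀ {m} → (ℕ → MPoly m) → (ℕ → MPoly m) → ℕ → MPoly m
convP F G zero    = F 0 ⊗ G 0
convP F G (suc n) = (F 0 ⊗ G (suc n)) ⊕ convP (λ t → F (suc t)) G n

eval-convP : ∀ {m} n (F G : ℕ → MPoly m) w →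
             eval (convP F G n) w ≡ conv (λ t → eval (F t) w) (λ t → eval (G t) w) n
eval-convP zero    F G w = refl
eval-convP (suc n) F G w = cong (eval (F 0) w * eval (G (suc n)) w +_) (eval-convP n (λ t → F (suc t)) G w)

convP-congʳ : ∀ {m} n (F : ℕ → MPoly m) {G G′ : ℕ → MPoly m} → (∀ t → t ≤ n → G t ≡ G′ t) →
              convP F G n ≡ convP F G′ n
convP-congʳ zero    F G≗G′ = cong (F 0 ⊗_) (G≗G′ 0 z≤n)
convP-congʳ (suc n) F G≗G′ = cong₂ (λ a b → (F 0 ⊗ a) ⊕ b) (G≗G′ (suc n) ℕ.≤-refl)
  (convP-congʳ n (λ t → F (suc t)) (λ t t≤n → G≗G′ t (ℕ.m≤n⇒m≤1+n t≤n)))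

convInitP : ∀ {m} → (ℕ → MPoly m) → (ℕ → MPoly m) → ℕ → MPoly m
convInitP F G zero    = con 0ℚ
convInitP F G (suc n) = convP F (λ s → G (suc s)) n

eval-convInitP : ∀ {m} n (F G : ℕ → MPoly m) w →
                 eval (convInitP F G n) w ≡ convInit (λ t → eval (F t) w) (λ t → eval (G t) w) n
eval-convInitP zero    F G w = refl
eval-convInitP (suc n) F G w = eval-convP n F (λ s → G (suc s)) w

-- Φ s is e_s as a polynomial in the power sums, Y t standing for p_{t+1}.
module FromPowerSums {m : ℕ} (Y : ℕ → MPoly m) where

  step : ℕ → (ℕ → MPoly m) → MPoly m
  step j P = con 1/[1+ j ] ⊗ convP (λ t → con (sgn t) ⊗ Y t) P j

  open CourseOfValues (con 1ℚ) step public using () renaming (cov to Φ)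
  open CourseOfValues (con 1ℚ) step using (cov-induction; cov-suc)

  Φ-correct : ∀ w (u : ℕ → ℚ) n → u 0 ≡ 1ℚ → (∀ j → j < n → NewtonAt (λ t → eval (Y t) w) u j) →
              ∀ s → s ≤ n → eval (Φ s) w ≡ u s
  Φ-correct w u n u0≡1 newtonAt = cov-induction (λ s P → s ≤ n → eval P w ≡ u s) (λ _ → sym u0≡1)
    λ s P P-correct s<n → begin
      1/[1+ s ] * eval (convP (λ t → con (sgn t) ⊗ Y t) P s) w
        ≡⟨ cong (1/[1+ s ] *_) (eval-convP s _ P w) ⟩
      1/[1+ s ] * conv (λ t → sgn t * eval (Y t) w) (λ t → eval (P t) w) s
        ≡⟨ cong (1/[1+ s ] *_) (conv-cong s (λ _ _ → refl)
                                 (λ t t≤s → P-correct t t≤s (ℕ.≤-trans t≤s (ℕ.<⇒≤ s<n)))) ⟩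
      1/[1+ s ] * conv (λ t → sgn t * eval (Y t) w) u s
        ≡⟨ cong (1/[1+ s ] *_) (newtonAt s s<n) ⟩
      1/[1+ s ] * (natℚ (suc s) * u (suc s))
        ≡⟨ sym ([1+n]*x≡y⇒x≡y/[1+n] s refl) ⟩
      u (suc s) ∎
    where open ≡-Reasoning

  Φ-newton : ∀ w j → NewtonAt (λ t → eval (Y t) w) (λ s → eval (Φ s) w) j
  Φ-newton w j = sym (begin
    natℚ (suc j) * eval (Φ (suc j)) w   ≡⟨ cong (λ P → natℚ (suc j) * eval P w) (cov-suc step-cong j) ⟩
    natℚ (suc j) * (1/[1+ j ] * eval (convP (λ t → con (sgn t) ⊗ Y t) Φ j) w)
      ≡⟨ [1+n]*[x/[1+n]]≡x j _ ⟩
    eval (convP (λ t → con (sgn t) ⊗ Y t) Φ j) w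
      ≡⟨ eval-convP j _ Φ w ⟩
    conv (λ t → sgn t * eval (Y t) w) (λ s → eval (Φ s) w) j ∎)
    where
    open ≡-Reasoning
    step-cong : ∀ s {g h} → (∀ t → t ≤ s → g t ≡ h t) → step s g ≡ step s h
    step-cong s g≗h = cong (con 1/[1+ s ] ⊗_) (convP-congʳ s _ g≗h)

-- Ψ j is p_{j+1} as a polynomial in the elementary symmetric functions, U s standing for e_s.
module FromElementary {m : ℕ} (U : ℕ → MPoly m) where

  step : ℕ → (ℕ → MPoly m) → MPoly m
  step j P = con (sgn j) ⊗ ((con (natℚ (suc j)) ⊗ U (suc j)) ⊕ (con (- 1ℚ) ⊗ convInitP (λ t → con (sgn t) ⊗ P t) U j))

  open CourseOfValues (step 0 (λ _ → con 0ℚ)) (λ j → step (suc j)) public using () renaming (cov to Ψ)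
  open CourseOfValues (step 0 (λ _ → con 0ℚ)) (λ j → step (suc j)) using (cov-induction)

  module _ (w : Fin m → ℚ) (u y : ℕ → ℚ) (n : ℕ) (u0≡1 : u 0 ≡ 1ℚ)
           (U-correct : ∀ s → s ≤ n → eval (U s) w ≡ u s)
           (newtonAt : ∀ j → j < n → NewtonAt y u j) where

    step-correct : ∀ j → j < n → (P : ℕ → MPoly m) → (∀ t → t < j → eval (P t) w ≡ y t) → eval (step j P) w ≡ y j
    step-correct j j<n P P-correct = begin
      sgn j * (natℚ (suc j) * eval (U (suc j)) w + - 1ℚ * eval (convInitP (λ t → con (sgn t) ⊗ P t) U j) w)
        ≡⟨ cong₂ (λ a b → sgn j * (natℚ (suc j) * a + - 1ℚ * b)) (U-correct (suc j) j<n)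
             (trans (eval-convInitP j _ U w)
                    (convInit-cong j (λ t t<j → cong (sgn t *_) (P-correct t t<j))
                                     (λ t t≤j → U-correct t (ℕ.≤-trans t≤j (ℕ.<⇒≤ j<n))))) ⟩
      sgn j * (natℚ (suc j) * u (suc j) + - 1ℚ * C)
        ≡⟨ cong (λ a → sgn j * (a + - 1ℚ * C)) (sym (newtonAt j j<n)) ⟩
      sgn j * (conv (λ t → sgn t * y t) u j + - 1ℚ * C)
        ≡⟨ cong (λ a → sgn j * (a + - 1ℚ * C)) (trans (conv≡convInit+last j _ u) (cong (λ v → C + sgn j * y j * v) u0≡1)) ⟩
      sgn j * ((C + sgn j * y j * 1ℚ) + - 1ℚ * C)
        ≡⟨ cancel (sgn j) C (y j) ⟩
      sgn j * sgn j * y j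
        ≡⟨ cong (_* y j) (sgn*sgn≡1 j) ⟩
      1ℚ * y j
        ≡⟨ *-identityˡ (y j) ⟩
      y j ∎
      where
      open ≡-Reasoning
      C = convInit (λ t → sgn t * y t) u j
      cancel : ∀ s c y → s * ((c + s * y * 1ℚ) + - 1ℚ * c) ≡ s * s * y
      cancel = solve-∀ ℚ-ring

    Ψ-correct : ∀ t → t < n → eval (Ψ t) w ≡ y t
    Ψ-correct = cov-induction (λ t P → t < n → eval P w ≡ y t)
      (λ 0<n → step-correct 0 0<n (λ _ → con 0ℚ) (λ _ ()))
      (λ s P P-correct s<n → step-correct (suc s) s<n P
        (λ t t<s → P-correct t (ℕ.≤-pred t<s) (ℕ.<-trans t<s s<n)))

-- Independence of the elementary symmetric functions

esym-beyond : ∀ xs j → length xs < j → esym xs j ≡ 0ℚ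
esym-beyond []       (suc j) _         = refl
esym-beyond (x ∷ xs) (suc j) (s≤s l<j) = begin
  esym xs (suc j) + x * esym xs j
    ≡⟨ cong₂ (λ a b → a + x * b) (esym-beyond xs (suc j) (ℕ.m≤n⇒m≤1+n l<j)) (esym-beyond xs j l<j) ⟩
  0ℚ + x * 0ℚ                     ≡⟨ trans (+-identityˡ _) (*-zeroʳ x) ⟩
  0ℚ                              ∎
  where open ≡-Reasoning

esym-0∷ : ∀ xs j → esym (0ℚ ∷ xs) j ≡ esym xs j
esym-0∷ xs zero    = refl
esym-0∷ xs (suc j) = trans (cong (esym xs (suc j) +_) (*-zeroˡ (esym xs j))) (+-identityʳ _)

esym[1+n]≡0 : ∀ {n} (x : Fin n → ℚ) → esym (toList x) (suc n) ≡ 0ℚ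
esym[1+n]≡0 x = esym-beyond (toList x) _ (ℕ.≤-reflexive (cong suc (length-tabulate x)))

esym-top≢0 : ∀ {n} (x : Fin n → ℚ) → AllPositive x → esym (toList x) n ≢ 0ℚ
esym-top≢0 {zero}  x x>0 = 1≢0
esym-top≢0 {suc n} x x>0 eq = x*y≢0 (>0⇒≢0 (x>0 zero)) (esym-top≢0 (tail x) (λ i → x>0 (suc i))) (begin
  head x * esym (toList (tail x)) n
    ≡⟨ sym (+-identityˡ _) ⟩
  0ℚ + head x * esym (toList (tail x)) n
    ≡⟨ cong (_+ head x * esym (toList (tail x)) n) (sym (esym[1+n]≡0 (tail x))) ⟩
  esym (toList (tail x)) (suc n) + head x * esym (toList (tail x)) n
    ≡⟨ eq ⟩
  0ℚ ∎)
  where open ≡-Reasoning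

esymP : ∀ {n} → ℕ → MPoly n
esymP {n}     zero    = con 1ℚ
esymP {zero}  (suc j) = con 0ℚ
esymP {suc n} (suc j) = rename suc (esymP (suc j)) ⊕ (var zero ⊗ rename suc (esymP j))

eval-esymP : ∀ {n} j (x : Fin n → ℚ) → eval (esymP j) x ≡ esym (toList x) j
eval-esymP {n}     zero    x = refl
eval-esymP {zero}  (suc j) x = refl
eval-esymP {suc n} (suc j) x = cong₂ (λ a b → a + head x * b)
  (trans (eval-rename suc (esymP (suc j)) x) (eval-esymP (suc j) (tail x)))
  (trans (eval-rename suc (esymP j) x) (eval-esymP j (tail x)))

-- (e_n, e_{n-1}, …, e_1), so that the head is the top elementary symmetric function
esymsRev : ∀ {n} → (Fin n → ℚ) → Fin n → ℚ
esymsRev {n} x i = esym (toList x) (n ∸ toℕ i)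

esyms : ∀ {n} → (Fin n → ℚ) → Fin n → ℚ
esyms x i = esym (toList x) (suc (toℕ i))

-- Split E along its head variable e_n, E = Σ_d c_d e_n^d.  Putting x₀ = 0 kills e_n and
-- leaves the e's of the other coordinates, so c_0 vanishes by induction on n; dividing
-- by e_n ≠ 0 at points with positive coordinates and extending to all points by
-- vanishes-on-positive⇒vanishes, one recurses on the remaining coefficients.
esymsRev-independent : ∀ {n} (E : MPoly n) → (∀ x → eval E (esymsRev x) ≡ 0ℚ) → ∀ z → eval E z ≡ 0ℚ
esymsRev-independent {zero}  E vanish z = trans (eval-cong E (λ ())) (vanish z)
esymsRev-independent {suc n} E vanish z = trans (sym (eval-horner-coefficients E z))
  (horner-independent (coefficients E) (λ x → trans (eval-horner-coefficients E (esymsRev x)) (vanish x)) z)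
  where
  horner-independent : ∀ cs → (∀ x → eval (horner cs) (esymsRev x) ≡ 0ℚ) → ∀ z → eval (horner cs) z ≡ 0ℚ
  horner-independent []       vanish z = refl
  horner-independent (c ∷ cs) vanish z = begin
    eval (horner (c ∷ cs)) z                     ≡⟨ eval-horner-∷ c cs z ⟩
    eval c (tail z) + head z * eval (horner cs) z ≡⟨ cong₂ (λ a b → a + head z * b) (c-vanishes (tail z)) (rest-vanishes z) ⟩
    0ℚ + head z * 0ℚ                             ≡⟨ trans (+-identityˡ _) (*-zeroʳ (head z)) ⟩
    0ℚ                                           ∎
    where
    open ≡-Reasoning
    c-vanishes-on-esyms : ∀ x → eval c (esymsRev x) ≡ 0ℚ
    c-vanishes-on-esyms x = begin
      eval c (esymsRev x)                            ≡⟨ eval-cong c (λ i → sym (esym-0∷ (toList x) (n ∸ toℕ i))) ⟩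
      eval c (tail y)                                ≡⟨ sym (x+0*y≡x (eval c (tail y)) (eval (horner cs) y)) ⟩
      eval c (tail y) + 0ℚ * eval (horner cs) y      ≡⟨ cong (λ e → eval c (tail y) + e * eval (horner cs) y) (sym e-top≡0) ⟩
      eval c (tail y) + head y * eval (horner cs) y  ≡⟨ sym (eval-horner-∷ c cs y) ⟩
      eval (horner (c ∷ cs)) y                       ≡⟨ vanish (0ℚ ∷ᶠ x) ⟩
      0ℚ                                             ∎
      where
      y = esymsRev (0ℚ ∷ᶠ x)
      e-top≡0 : head y ≡ 0ℚ
      e-top≡0 = trans (esym-0∷ (toList x) (suc n)) (esym[1+n]≡0 x)
    c-vanishes : ∀ w → eval c w ≡ 0ℚ
    c-vanishes = esymsRev-independent c c-vanishes-on-esyms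
    R : MPoly (suc n)
    R = substitute (horner cs) (λ i → esymP (suc n ∸ toℕ i))
    eval-R : ∀ x → eval R x ≡ eval (horner cs) (esymsRev x)
    eval-R x = trans (eval-substitute (horner cs) _ x) (eval-cong (horner cs) (λ i → eval-esymP (suc n ∸ toℕ i) x))
    R-vanishes-on-positive : ∀ x → AllPositive x → eval R x ≡ 0ℚ
    R-vanishes-on-positive x x>0 = trans (eval-R x) (x*y≡0⇒y≡0 (esym-top≢0 x x>0) (begin
      head (esymsRev x) * eval (horner cs) (esymsRev x)
        ≡⟨ sym (+-identityˡ _) ⟩
      0ℚ + head (esymsRev x) * eval (horner cs) (esymsRev x)
        ≡⟨ cong (_+ _) (sym (c-vanishes (tail (esymsRev x)))) ⟩
      eval c (tail (esymsRev x)) + head (esymsRev x) * eval (horner cs) (esymsRev x)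
        ≡⟨ sym (eval-horner-∷ c cs (esymsRev x)) ⟩
      eval (horner (c ∷ cs)) (esymsRev x)
        ≡⟨ vanish x ⟩
      0ℚ ∎))
    rest-vanishes : ∀ z → eval (horner cs) z ≡ 0ℚ
    rest-vanishes = horner-independent cs (λ x → trans (sym (eval-R x)) (vanishes-on-positive⇒vanishes R R-vanishes-on-positive x))

esymsRev∘opposite≗esyms : ∀ {n} (x : Fin n → ℚ) (i : Fin n) → esymsRev x (opposite i) ≡ esyms x i
esymsRev∘opposite≗esyms {n} x i =
  cong (esym (toList x)) (trans (cong (n ∸_) (opposite-prop i)) (ℕ.m∸[m∸n]≡n (toℕ<n i)))

esyms-independent : ∀ {n} (E : MPoly n) → (∀ x → eval E (esyms x) ≡ 0ℚ) → ∀ z → eval E z ≡ 0ℚ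
esyms-independent E vanish z = begin
  eval E z                                   ≡⟨ eval-cong E (λ i → cong z (sym (opposite-involutive i))) ⟩
  eval E (λ i → z (opposite (opposite i)))   ≡⟨ sym (eval-rename opposite E (λ i → z (opposite i))) ⟩
  eval (rename opposite E) (λ i → z (opposite i))
    ≡⟨ esymsRev-independent (rename opposite E) vanish-reversed (λ i → z (opposite i)) ⟩
  0ℚ                                         ∎
  where
  open ≡-Reasoning
  vanish-reversed : ∀ x → eval (rename opposite E) (esymsRev x) ≡ 0ℚ
  vanish-reversed x = trans (eval-rename opposite E (esymsRev x)) (trans (eval-cong E (esymsRev∘opposite≗esyms x)) (vanish x))

-- μ t = t + 2 is the variable of the paper's factors λ - nᵢ + 2 = μ - nᵢ
μ : ℚ → ℚ
μ t = t + (1ℚ + 1ℚ)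

expandTerm : (ℕ → ℚ) → List ℚ → ℚ → ℕ → ℚ
expandTerm u xs t j = u j * esym xs j * pow (μ t) (length xs ∸ j)

expand : (ℕ → ℚ) → List ℚ → ℚ → ℚ
expand u xs t = ∑ (suc (length xs)) (expandTerm u xs t)

expand-cong : ∀ {u v : ℕ → ℚ} xs t → (∀ j → u j ≡ v j) → expand u xs t ≡ expand v xs t
expand-cong xs t u≗v = ∑-cong (suc (length xs)) (λ j _ → cong (λ a → a * esym xs j * pow (μ t) (length xs ∸ j)) (u≗v j))

expand-* : ∀ c (u : ℕ → ℚ) xs t → expand (λ j → c * u j) xs t ≡ c * expand u xs t
expand-* c u xs t = trans (∑-cong (suc (length xs)) (λ j _ → assoc c (u j) (esym xs j) (pow (μ t) (length xs ∸ j))))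
                          (*-distribˡ-∑ (suc (length xs)) c (expandTerm u xs t))
  where
  assoc : ∀ c a b d → c * a * b * d ≡ c * (a * b * d)
  assoc = solve-∀ ℚ-ring

expand-+ : ∀ (u v : ℕ → ℚ) xs t → expand (λ j → u j + v j) xs t ≡ expand u xs t + expand v xs t
expand-+ u v xs t = trans (∑-cong (suc (length xs)) (λ j _ → distrib (u j) (v j) (esym xs j) (pow (μ t) (length xs ∸ j))))
                          (∑-distrib-+ (suc (length xs)) (expandTerm u xs t) (expandTerm v xs t))
  where
  distrib : ∀ a c b d → (a + c) * b * d ≡ a * b * d + c * b * d
  distrib = solve-∀ ℚ-ring

-- the recursion e_{j+1}(x ∷ xs) = e_{j+1}(xs) + x e_j(xs), summed against the powers of μ
expand-∷ : ∀ u x xs t → expand u (x ∷ xs) t ≡ μ t * expand u xs t + x * expand (u ∘ suc) xs t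
expand-∷ u x xs t = begin
  u 0 * 1ℚ * pow m (suc k) + ∑[ j < suc k ] (u (suc j) * (e (suc j) + x * e j) * pow m (k ∸ j))
    ≡⟨ cong (u 0 * 1ℚ * pow m (suc k) +_) (trans
         (∑-cong (suc k) (λ j _ → distrib (u (suc j)) (e (suc j)) (e j) x (pow m (k ∸ j))))
         (trans (∑-distrib-+ (suc k) (λ j → u (suc j) * e (suc j) * pow m (k ∸ j)) (λ j → x * (u (suc j) * e j * pow m (k ∸ j))))
                (cong (upper +_) (*-distribˡ-∑ (suc k) x (λ j → u (suc j) * e j * pow m (k ∸ j)))))) ⟩
  u 0 * 1ℚ * pow m (suc k) + (upper + x * expand (u ∘ suc) xs t)
    ≡⟨ cong (λ z → u 0 * 1ℚ * pow m (suc k) + (z + x * expand (u ∘ suc) xs t)) upper≡m*lower ⟩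
  u 0 * 1ℚ * pow m (suc k) + (m * lower + x * expand (u ∘ suc) xs t)
    ≡⟨ regroup (u 0) m (pow m k) lower x (expand (u ∘ suc) xs t) ⟩
  m * expand u xs t + x * expand (u ∘ suc) xs t ∎
  where
  open ≡-Reasoning
  k = length xs
  m = μ t
  e = esym xs
  upper = ∑[ j < suc k ] (u (suc j) * e (suc j) * pow m (k ∸ j))
  lower = ∑[ j < k ] (u (suc j) * e (suc j) * pow m (k ∸ suc j))
  distrib : ∀ a b c x p → a * (b + x * c) * p ≡ a * b * p + x * (a * c * p)
  distrib = solve-∀ ℚ-ring
  regroup : ∀ a m p r x s → a * 1ℚ * (m * p) + (m * r + x * s) ≡ m * (a * 1ℚ * p + r) + x * s
  regroup = solve-∀ ℚ-ring
  pull-μ : ∀ a b m p → a * b * (m * p) ≡ m * (a * b * p)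
  pull-μ = solve-∀ ℚ-ring
  k∸j≡1+k∸[1+j] : ∀ k j → j < k → k ∸ j ≡ suc (k ∸ suc j)
  k∸j≡1+k∸[1+j] (suc k) zero    _         = refl
  k∸j≡1+k∸[1+j] (suc k) (suc j) (s≤s j<k) = k∸j≡1+k∸[1+j] k j j<k
  upper≡m*lower : upper ≡ m * lower
  upper≡m*lower = begin
    upper
      ≡⟨ ∑-last k (λ j → u (suc j) * e (suc j) * pow m (k ∸ j)) ⟩
    ∑[ j < k ] (u (suc j) * e (suc j) * pow m (k ∸ j)) + u (suc k) * e (suc k) * pow m (k ∸ k)
      ≡⟨ cong₂ _+_
           (∑-cong k (λ j j<k → trans (cong (λ d → u (suc j) * e (suc j) * pow m d) (k∸j≡1+k∸[1+j] k j j<k))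
                                      (pull-μ (u (suc j)) (e (suc j)) m (pow m (k ∸ suc j)))))
           (trans (cong (λ z → u (suc k) * z * pow m (k ∸ k)) (esym-beyond xs (suc k) ℕ.≤-refl))
                  (trans (cong (_* pow m (k ∸ k)) (*-zeroʳ (u (suc k)))) (*-zeroˡ (pow m (k ∸ k))))) ⟩
    ∑[ j < k ] (m * (u (suc j) * e (suc j) * pow m (k ∸ suc j))) + 0ℚ
      ≡⟨ trans (+-identityʳ _) (*-distribˡ-∑ k m (λ j → u (suc j) * e (suc j) * pow m (k ∸ suc j))) ⟩
    m * lower ∎

evalU-linF : ∀ x t → evalU (linF x) t ≡ μ t - x
evalU-linF x t = identity x t
  where
  identity : ∀ x t → (1ℚ + 1ℚ - x) + t * (1ℚ + t * 0ℚ) ≡ t + (1ℚ + 1ℚ) - x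
  identity = solve-∀ ℚ-ring

∏linF : List ℚ → UPoly
∏linF xs = prodP (map linF xs)

evalU-∏linF-∷ : ∀ x xs t → evalU (∏linF (x ∷ xs)) t ≡ (μ t - x) * evalU (∏linF xs) t
evalU-∏linF-∷ x xs t = trans (evalU-*P (linF x) (∏linF xs) t) (cong (_* evalU (∏linF xs) t) (evalU-linF x t))

evalU-∏linF : ∀ xs t → evalU (∏linF xs) t ≡ expand sgn xs t
evalU-∏linF []       t = base t
  where
  base : ∀ t → 1ℚ + t * 0ℚ ≡ 1ℚ * 1ℚ * 1ℚ + 0ℚ
  base = solve-∀ ℚ-ring
evalU-∏linF (x ∷ xs) t = begin
  evalU (∏linF (x ∷ xs)) t                     ≡⟨ evalU-∏linF-∷ x xs t ⟩
  (μ t - x) * evalU (∏linF xs) t               ≡⟨ cong ((μ t - x) *_) (evalU-∏linF xs t) ⟩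
  (μ t - x) * expand sgn xs t                  ≡⟨ distrib (μ t) x (expand sgn xs t) ⟩
  μ t * expand sgn xs t + x * (- 1ℚ * expand sgn xs t)
    ≡⟨ cong (λ z → μ t * expand sgn xs t + x * z)
            (sym (trans (expand-cong xs t (λ j → -x≡-1*x (sgn j))) (expand-* (- 1ℚ) sgn xs t))) ⟩
  μ t * expand sgn xs t + x * expand (sgn ∘ suc) xs t ≡⟨ sym (expand-∷ sgn x xs t) ⟩
  expand sgn (x ∷ xs) t                        ∎
  where
  open ≡-Reasoning
  distrib : ∀ m x s → (m - x) * s ≡ m * s + x * (- 1ℚ * s)
  distrib = solve-∀ ℚ-ring
  -x≡-1*x : ∀ x → - x ≡ - 1ℚ * x
  -x≡-1*x = solve-∀ ℚ-ring

pickTerm : ℚ × List ℚ → UPoly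
pickTerm (n , rest) = scaleP n (∏linF rest)

∑picks : List ℚ → UPoly
∑picks xs = sumP (map pickTerm (picks xs))

evalU-∑picks-∷ : ∀ x xs t → evalU (∑picks (x ∷ xs)) t ≡ x * evalU (∏linF xs) t + (μ t - x) * evalU (∑picks xs) t
evalU-∑picks-∷ x xs t = trans (evalU-+P (pickTerm (x , xs)) (sumP (map pickTerm (map insert (picks xs)))) t)
  (cong₂ _+_ (evalU-scaleP x (∏linF xs) t) (∑-insert (picks xs)))
  where
  insert : ℚ × List ℚ → ℚ × List ℚ
  insert p = proj₁ p , x ∷ proj₂ p
  factor : ∀ y l a r → y * (l * a) + l * r ≡ l * (y * a + r)
  factor = solve-∀ ℚ-ring
  ∑-insert : ∀ ps → evalU (sumP (map pickTerm (map insert ps))) t ≡ (μ t - x) * evalU (sumP (map pickTerm ps)) t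
  ∑-insert []       = sym (*-zeroʳ (μ t - x))
  ∑-insert (p ∷ ps) = begin
    evalU (pickTerm (insert p) +P sumP (map pickTerm (map insert ps))) t
      ≡⟨ evalU-+P (pickTerm (insert p)) (sumP (map pickTerm (map insert ps))) t ⟩
    evalU (pickTerm (insert p)) t + evalU (sumP (map pickTerm (map insert ps))) t
      ≡⟨ cong₂ _+_ (trans (evalU-scaleP (proj₁ p) (∏linF (x ∷ proj₂ p)) t)
                          (cong (proj₁ p *_) (evalU-∏linF-∷ x (proj₂ p) t)))
                   (∑-insert ps) ⟩
    proj₁ p * ((μ t - x) * evalU (∏linF (proj₂ p)) t) + (μ t - x) * evalU (sumP (map pickTerm ps)) t
      ≡⟨ factor (proj₁ p) (μ t - x) (evalU (∏linF (proj₂ p)) t) (evalU (sumP (map pickTerm ps)) t) ⟩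
    (μ t - x) * (proj₁ p * evalU (∏linF (proj₂ p)) t + evalU (sumP (map pickTerm ps)) t)
      ≡⟨ cong ((μ t - x) *_) (sym (trans (evalU-+P (pickTerm p) (sumP (map pickTerm ps)) t)
                                        (cong (_+ evalU (sumP (map pickTerm ps)) t) (evalU-scaleP (proj₁ p) (∏linF (proj₂ p)) t)))) ⟩
    (μ t - x) * evalU (sumP (map pickTerm (p ∷ ps))) t ∎
    where open ≡-Reasoning

weight : ℕ → ℚ
weight j = sgn j * natℚ (suc j)

evalU-gPoly : ∀ xs t → evalU (gPoly xs) t ≡ expand weight xs t
evalU-gPoly xs t = trans (evalU-+P (∏linF xs) (scaleP (- 1ℚ) (∑picks xs)) t)
  (trans (cong (evalU (∏linF xs) t +_) (evalU-scaleP (- 1ℚ) (∑picks xs) t)) (difference xs))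
  where
  difference : ∀ xs → evalU (∏linF xs) t + - 1ℚ * evalU (∑picks xs) t ≡ expand weight xs t
  difference []       = base t
    where
    base : ∀ t → (1ℚ + t * 0ℚ) + - 1ℚ * 0ℚ ≡ 1ℚ * (1ℚ + 0ℚ) * 1ℚ * 1ℚ + 0ℚ
    base = solve-∀ ℚ-ring
  difference (x ∷ xs) = begin
    evalU (∏linF (x ∷ xs)) t + - 1ℚ * evalU (∑picks (x ∷ xs)) t
      ≡⟨ cong₂ (λ a b → a + - 1ℚ * b) (evalU-∏linF-∷ x xs t) (evalU-∑picks-∷ x xs t) ⟩
    (μ t - x) * A + - 1ℚ * (x * A + (μ t - x) * B)
      ≡⟨ regroup (μ t) x A B ⟩
    μ t * (A + - 1ℚ * B) + x * (- 1ℚ * (A + (A + - 1ℚ * B)))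
      ≡⟨ cong₂ (λ a d → μ t * d + x * (- 1ℚ * (a + d))) (evalU-∏linF xs t) (difference xs) ⟩
    μ t * expand weight xs t + x * (- 1ℚ * (expand sgn xs t + expand weight xs t))
      ≡⟨ cong (λ z → μ t * expand weight xs t + x * z) (sym weight-suc) ⟩
    μ t * expand weight xs t + x * expand (weight ∘ suc) xs t
      ≡⟨ sym (expand-∷ weight x xs t) ⟩
    expand weight (x ∷ xs) t ∎
    where
    open ≡-Reasoning
    A = evalU (∏linF xs) t
    B = evalU (∑picks xs) t
    regroup : ∀ m x a b → (m - x) * a + - 1ℚ * (x * a + (m - x) * b) ≡ m * (a + - 1ℚ * b) + x * (- 1ℚ * (a + (a + - 1ℚ * b)))
    regroup = solve-∀ ℚ-ring
    weight-step : ∀ s n → - s * (1ℚ + n) ≡ - 1ℚ * (s + s * n)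
    weight-step = solve-∀ ℚ-ring
    weight-suc : expand (weight ∘ suc) xs t ≡ - 1ℚ * (expand sgn xs t + expand weight xs t)
    weight-suc = trans (expand-cong xs t (λ j → weight-step (sgn j) (natℚ (suc j))))
      (trans (expand-* (- 1ℚ) (λ j → sgn j + weight j) xs t) (cong (- 1ℚ *_) (expand-+ sgn weight xs t)))

μ^ : ℕ → UPoly
μ^ d = ∏linF (replicate d 0ℚ)

evalU-μ^ : ∀ d t → evalU (μ^ d) t ≡ pow (μ t) d
evalU-μ^ zero    t = x+y*0≡x 1ℚ t
evalU-μ^ (suc d) t = trans (evalU-∏linF-∷ 0ℚ (replicate d 0ℚ) t) (cong₂ _*_ (minus-0 (μ t)) (evalU-μ^ d t))
  where
  minus-0 : ∀ m → m - 0ℚ ≡ m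
  minus-0 = solve-∀ ℚ-ring

coeff-linF*P : ∀ a q e → coeff (linF a *P q) (suc e) ≡ (1ℚ + 1ℚ - a) * coeff q (suc e) + coeff q e
coeff-linF*P a q e = begin
  coeff (scaleP (1ℚ + 1ℚ - a) q +P (0ℚ ∷ (1ℚ ∷ []) *P q)) (suc e)
    ≡⟨ coeff-+P (scaleP (1ℚ + 1ℚ - a) q) (0ℚ ∷ (1ℚ ∷ []) *P q) (suc e) ⟩
  coeff (scaleP (1ℚ + 1ℚ - a) q) (suc e) + coeff (scaleP 1ℚ q +P (0ℚ ∷ [])) e
    ≡⟨ cong₂ _+_ (coeff-scaleP (1ℚ + 1ℚ - a) q (suc e))
                 (trans (coeff-+P (scaleP 1ℚ q) (0ℚ ∷ []) e) (cong₂ _+_ (coeff-scaleP 1ℚ q e) (coeff-0∷[] e))) ⟩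
  (1ℚ + 1ℚ - a) * coeff q (suc e) + (1ℚ * coeff q e + 0ℚ)
    ≡⟨ cong ((1ℚ + 1ℚ - a) * coeff q (suc e) +_) (trans (+-identityʳ _) (*-identityˡ (coeff q e))) ⟩
  (1ℚ + 1ℚ - a) * coeff q (suc e) + coeff q e ∎
  where
  open ≡-Reasoning
  coeff-0∷[] : ∀ e → coeff (0ℚ ∷ []) e ≡ 0ℚ
  coeff-0∷[] zero    = refl
  coeff-0∷[] (suc e) = refl

coeff-μ^-above : ∀ d e → d < e → coeff (μ^ d) e ≡ 0ℚ
coeff-μ^-above zero    (suc e) _         = refl
coeff-μ^-above (suc d) (suc e) (s≤s d<e) = begin
  coeff (μ^ (suc d)) (suc e)                       ≡⟨ coeff-linF*P 0ℚ (μ^ d) e ⟩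
  c * coeff (μ^ d) (suc e) + coeff (μ^ d) e
    ≡⟨ cong₂ (λ a b → c * a + b) (coeff-μ^-above d (suc e) (ℕ.m≤n⇒m≤1+n d<e)) (coeff-μ^-above d e d<e) ⟩
  c * 0ℚ + 0ℚ                                      ≡⟨ trans (+-identityʳ _) (*-zeroʳ c) ⟩
  0ℚ                                               ∎
  where
  open ≡-Reasoning
  c = 1ℚ + 1ℚ - 0ℚ

coeff-μ^-top : ∀ d → coeff (μ^ d) d ≡ 1ℚ
coeff-μ^-top zero    = refl
coeff-μ^-top (suc d) = begin
  coeff (μ^ (suc d)) (suc d)                 ≡⟨ coeff-linF*P 0ℚ (μ^ d) d ⟩
  c * coeff (μ^ d) (suc d) + coeff (μ^ d) d
    ≡⟨ cong₂ (λ a b → c * a + b) (coeff-μ^-above d (suc d) ℕ.≤-refl) (coeff-μ^-top d) ⟩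
  c * 0ℚ + 1ℚ                                ≡⟨ trans (cong (_+ 1ℚ) (*-zeroʳ c)) (+-identityˡ 1ℚ) ⟩
  1ℚ                                         ∎
  where
  open ≡-Reasoning
  c = 1ℚ + 1ℚ - 0ℚ

coeff-gPoly : ∀ xs d → coeff (gPoly xs) d ≡ ∑[ j < suc (length xs) ] (weight j * esym xs j * coeff (μ^ (length xs ∸ j)) d)
coeff-gPoly xs d = begin
  coeff (gPoly xs) d ≡⟨ coeff-unique (gPoly xs) expanded (λ t → trans (evalU-gPoly xs t) (sym (evalU-expanded t))) d ⟩
  coeff expanded d   ≡⟨ coeff-∑P (suc k) term d ⟩
  ∑[ j < suc k ] coeff (term j) d ≡⟨ ∑-cong (suc k) (λ j _ → coeff-scaleP (weight j * esym xs j) (μ^ (k ∸ j)) d) ⟩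
  ∑[ j < suc k ] (weight j * esym xs j * coeff (μ^ (k ∸ j)) d) ∎
  where
  open ≡-Reasoning
  k = length xs
  term : ℕ → UPoly
  term j = scaleP (weight j * esym xs j) (μ^ (k ∸ j))
  expanded = ∑P (suc k) term
  evalU-expanded : ∀ t → evalU expanded t ≡ expand weight xs t
  evalU-expanded t = trans (evalU-∑P (suc k) term t) (∑-cong (suc k) (λ j _ →
    trans (evalU-scaleP (weight j * esym xs j) (μ^ (k ∸ j)) t) (cong (weight j * esym xs j *_) (evalU-μ^ (k ∸ j) t))))

coeff-gPoly-from-top : ∀ {k} xs i → length xs ≡ k → i ≤ k →
  coeff (gPoly xs) (k ∸ i) ≡ ∑[ j < i ] (weight j * esym xs j * coeff (μ^ (k ∸ j)) (k ∸ i)) + weight i * esym xs i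
coeff-gPoly-from-top {k} xs i refl i≤k = begin
  coeff (gPoly xs) (k ∸ i)   ≡⟨ coeff-gPoly xs (k ∸ i) ⟩
  ∑ (suc k) term             ≡⟨ ∑-vanishing-tail (suc k) i term (s≤s i≤k) higher-terms-vanish ⟩
  ∑ i term + term i          ≡⟨ cong (λ c → ∑ i term + weight i * esym xs i * c) (coeff-μ^-top (k ∸ i)) ⟩
  ∑ i term + weight i * esym xs i * 1ℚ ≡⟨ cong (∑ i term +_) (*-identityʳ _) ⟩
  ∑ i term + weight i * esym xs i ∎
  where
  open ≡-Reasoning
  term : ℕ → ℚ
  term j = weight j * esym xs j * coeff (μ^ (k ∸ j)) (k ∸ i)
  higher-terms-vanish : ∀ j → i < j → j < suc k → term j ≡ 0ℚ
  higher-terms-vanish j i<j (s≤s j≤k) =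
    trans (cong (weight j * esym xs j *_) (coeff-μ^-above (k ∸ j) (k ∸ i) (ℕ.∸-monoʳ-< i<j j≤k))) (*-zeroʳ (weight j * esym xs j))

module Construction (k m : ℕ) where
  open FromPowerSums (varAt {m}) using (Φ; Φ-correct)

  lowerCoeff : ℕ → ℚ
  lowerCoeff j = weight j * coeff (μ^ (k ∸ j)) (k ∸ suc m)

  leading : ℚ
  leading = weight (suc m) * 1/[1+ m ] * sgn m

  G : MPoly m
  G = ∑M (suc m) (λ j → con (lowerCoeff j) ⊗ Φ j)
      ⊕ (con (weight (suc m) * 1/[1+ m ]) ⊗ convInitP (λ t → con (sgn t) ⊗ varAt t) Φ m)

  F : MPoly (suc m)
  F = (con leading ⊗ var (fromℕ m)) ⊕ rename inject₁ G

  eval-F : ∀ y → eval F y ≡ leading * y (fromℕ m) + eval G (λ t → y (inject₁ t))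
  eval-F y = cong (leading * y (fromℕ m) +_) (eval-rename inject₁ G y)

  leading≢0 : leading ≢ 0ℚ
  leading≢0 = x*y≢0 (x*y≢0 (x*y≢0 (sgn≢0 (suc m)) (>0⇒≢0 (natℚ-suc>0 (suc m)))) (1/[1+n]≢0 m)) (sgn≢0 m)

  F-represents-ξ : suc m ≤ k → ∀ ns → ξ k (suc m) ns ≡ eval F (λ t → ψ (suc (toℕ t)) ns)
  F-represents-ξ m<k ns = begin
    coeff (gPoly xs) (k ∸ suc m)
      ≡⟨ coeff-gPoly-from-top xs (suc m) (length-toList ns) m<k ⟩
    ∑[ j < suc m ] (weight j * e j * coeff (μ^ (k ∸ j)) (k ∸ suc m)) + weight (suc m) * e (suc m)
      ≡⟨ cong₂ _+_ (∑-cong (suc m) (λ j _ → swap (weight j) (e j) (coeff (μ^ (k ∸ j)) (k ∸ suc m))))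
                   (cong (weight (suc m) *_) (newton-solved m refl (newton xs m))) ⟩
    lower + weight (suc m) * (1/[1+ m ] * (C + sgn m * P))
      ≡⟨ regroup lower (weight (suc m)) 1/[1+ m ] C (sgn m) P ⟩
    leading * P + (lower + weight (suc m) * 1/[1+ m ] * C)
      ≡⟨ cong₂ (λ a b → leading * a + b) (cong (λ z → psum xs (suc z)) (sym (toℕ-fromℕ m))) (sym eval-G) ⟩
    leading * psum xs (suc (toℕ (fromℕ m))) + eval G w
      ≡⟨ sym (eval-F (λ t → ψ (suc (toℕ t)) ns)) ⟩
    eval F (λ t → ψ (suc (toℕ t)) ns) ∎
    where
    open ≡-Reasoning
    xs = Vec.toList ns
    e = esym xs
    P = psum xs (suc m)
    C = convInit (λ t → sgn t * psum xs (suc t)) e m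
    lower = ∑[ j < suc m ] (lowerCoeff j * e j)
    swap : ∀ w e b → w * e * b ≡ w * b * e
    swap = solve-∀ ℚ-ring
    regroup : ∀ s w i c σ p → s + w * (i * (c + σ * p)) ≡ w * i * σ * p + (s + w * i * c)
    regroup = solve-∀ ℚ-ring
    w : Fin m → ℚ
    w i = ψ (suc (toℕ (inject₁ i))) ns
    varAt-correct : ∀ t → t < m → eval (varAt t) w ≡ psum xs (suc t)
    varAt-correct t t<m = trans (eval-cong (varAt {m} t) (λ i → cong (λ z → psum xs (suc z)) (toℕ-inject₁ i)))
                                (eval-varAt (λ t → psum xs (suc t)) t t<m)
    Φ-e : ∀ s → s ≤ m → eval (Φ s) w ≡ e s
    Φ-e = Φ-correct w e m refl λ j j<m →
      trans (conv-cong j (λ t t≤j → cong (sgn t *_) (varAt-correct t (ℕ.≤-<-trans t≤j j<m))) (λ _ _ → refl)) (newton xs j)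
    eval-G : eval G w ≡ lower + weight (suc m) * 1/[1+ m ] * C
    eval-G = cong₂ _+_
      (trans (eval-∑M (suc m) (λ j → con (lowerCoeff j) ⊗ Φ j) w)
             (∑-cong (suc m) (λ j j≤m → cong (lowerCoeff j *_) (Φ-e j (ℕ.≤-pred j≤m)))))
      (cong (weight (suc m) * 1/[1+ m ] *_)
        (trans (eval-convInitP m (λ t → con (sgn t) ⊗ varAt t) Φ w)
               (convInit-cong m (λ t t<m → cong (sgn t *_) (varAt-correct t t<m)) Φ-e)))

-- Independence of the power sums

pad : ∀ {n k} → n ≤ k → (Fin n → ℚ) → Vec ℚ k
pad {k = k} z≤n       x = Vec.replicate k 0ℚ
pad         (s≤s n≤k) x = head x Vec.∷ pad n≤k (tail x)

psum-pad : ∀ {n k} (n≤k : n ≤ k) (x : Fin n → ℚ) t → psum (Vec.toList (pad n≤k x)) (suc t) ≡ psum (toList x) (suc t)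
psum-pad {k = k} z≤n       x t = psum-zeros k
  where
  psum-zeros : ∀ k → psum (Vec.toList (Vec.replicate k 0ℚ)) (suc t) ≡ 0ℚ
  psum-zeros zero    = refl
  psum-zeros (suc k) = trans (cong₂ _+_ (*-zeroˡ (pow 0ℚ t)) (psum-zeros k)) (+-identityˡ 0ℚ)
psum-pad (s≤s n≤k) x t = cong (pow (head x) (suc t) +_) (psum-pad n≤k (tail x) t)

esymVar : ∀ {n} → ℕ → MPoly n
esymVar zero    = con 1ℚ
esymVar (suc s) = varAt s

eval-esymVar : ∀ {n} (u : ℕ → ℚ) → u 0 ≡ 1ℚ → ∀ s → s ≤ n →
               eval (esymVar s) (λ (i : Fin n) → u (suc (toℕ i))) ≡ u s
eval-esymVar u u0≡1 zero    _   = sym u0≡1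
eval-esymVar u u0≡1 (suc s) s<n = eval-varAt (u ∘ suc) s s<n

-- Pull D back along the power sums written in terms of the e's (Ψ); the e's are independent,
-- and every point y is the image under Ψ of the e-values Φ(y) that Newton's identities assign to y.
psums-independent : ∀ {n k} → n ≤ k → (D : MPoly n) →
                    (∀ (ns : Vec ℚ k) → eval D (λ i → ψ (suc (toℕ i)) ns) ≡ 0ℚ) → ∀ y → eval D y ≡ 0ℚ
psums-independent {n} n≤k D vanish y = begin
  eval D y                            ≡⟨ eval-cong D (λ i → sym (Ψ-Φ i)) ⟩
  eval D (λ i → eval (Ψ (toℕ i)) z)   ≡⟨ sym (eval-substitute D (λ i → Ψ (toℕ i)) z) ⟩
  eval E z                            ≡⟨ esyms-independent E E-vanishes z ⟩
  0ℚ                                  ∎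
  where
  open ≡-Reasoning
  open FromElementary (esymVar {n}) using (Ψ; Ψ-correct)
  open FromPowerSums (varAt {n}) using (Φ; Φ-newton)
  E : MPoly n
  E = substitute D (λ i → Ψ (toℕ i))
  Ψ-psum : ∀ x i → eval (Ψ (toℕ i)) (esyms x) ≡ psum (toList x) (suc (toℕ i))
  Ψ-psum x i = Ψ-correct (esyms x) (esym (toList x)) (λ t → psum (toList x) (suc t)) n refl
    (eval-esymVar (esym (toList x)) refl) (λ j _ → newton (toList x) j) (toℕ i) (toℕ<n i)
  E-vanishes : ∀ x → eval E (esyms x) ≡ 0ℚ
  E-vanishes x = begin
    eval E (esyms x)                             ≡⟨ eval-substitute D (λ i → Ψ (toℕ i)) (esyms x) ⟩
    eval D (λ i → eval (Ψ (toℕ i)) (esyms x))    ≡⟨ eval-cong D (λ i → trans (Ψ-psum x i) (sym (psum-pad n≤k x (toℕ i)))) ⟩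
    eval D (λ i → ψ (suc (toℕ i)) (pad n≤k x))   ≡⟨ vanish (pad n≤k x) ⟩
    0ℚ                                           ∎
  u : ℕ → ℚ
  u s = eval (Φ s) y
  z : Fin n → ℚ
  z i = u (suc (toℕ i))
  Ψ-Φ : ∀ i → eval (Ψ (toℕ i)) z ≡ y i
  Ψ-Φ i = trans (Ψ-correct z u (λ t → eval (varAt t) y) n refl (eval-esymVar u refl) (λ j _ → Φ-newton y j) (toℕ i) (toℕ<n i))
                (eval-varAt-toℕ i y)

psums-represent-uniquely : ∀ {n k} → n ≤ k → (f : Vec ℚ k → ℚ) (F F′ : MPoly n) →
  (∀ ns → f ns ≡ eval F (λ i → ψ (suc (toℕ i)) ns)) → (∀ ns → f ns ≡ eval F′ (λ i → ψ (suc (toℕ i)) ns)) →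
  ∀ y → eval F y ≡ eval F′ y
psums-represent-uniquely n≤k f F F′ F-represents F′-represents y =
  x+-1*y≡0⇒x≡y (psums-independent n≤k (F ⊕ (con (- 1ℚ) ⊗ F′)) difference-vanishes y)
  where
  difference-vanishes : ∀ ns → eval F (λ i → ψ (suc (toℕ i)) ns) + - 1ℚ * eval F′ (λ i → ψ (suc (toℕ i)) ns) ≡ 0ℚ
  difference-vanishes ns = trans (cong₂ (λ a b → a + - 1ℚ * b) (sym (F-represents ns)) (sym (F′-represents ns))) (x+-1*x≡0 (f ns))

lemma2p5 : (k m : ℕ) → m < k →
    Σ (MPoly (suc m)) λ F →
      ((ns : Vec ℚ k) → ξ k (suc m) ns ≡ eval F (λ t → ψ (suc (toℕ t)) ns))
      × ((F′ : MPoly (suc m)) →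
           ((ns : Vec ℚ k) → ξ k (suc m) ns ≡ eval F′ (λ t → ψ (suc (toℕ t)) ns)) →
           (y : Fin (suc m) → ℚ) → eval F y ≡ eval F′ y)
      × Σ ℚ λ c → (c ≢ 0ℚ) × Σ (MPoly m) λ G →
           (y : Fin (suc m) → ℚ) → eval F y ≡ c * y (fromℕ m) + eval G (λ t → y (inject₁ t))
lemma2p5 k m m<k =
  F , F-represents-ξ m<k , (λ F′ → psums-represent-uniquely m<k (ξ k (suc m)) F F′ (F-represents-ξ m<k)) ,
  leading , leading≢0 , G , eval-F
  where open Construction k m
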